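{- There is $\varepsilon_0>0$ such that for all $\varepsilon\in(0,\varepsilon_0]$ there is $n_0$ such that for all $n\ge n_0$ the following holds. Let $G$ be a tripartite digraph with parts $V_1,V_2,V_3$ where $(1-\varepsilon)n\le|V_1|\le n$ and $|V_2|=|V_3|=n$. Suppose that for each $i\in[3]$ and $v\in V_i$ we have $d^+(v,V_{i+1})\ge(1-\varepsilon)n$ and $d^-(v,V_{i-1})\ge(1-\varepsilon)n$ (indices modulo $3$ in $\{1,2,3\}$). Let $M$ be a matching in $G$ consisting of precisely $n-|V_1|$ edges, each directed from $V_3$ to $V_2$. Then $G$ contains a Hamilton cycle $C$ with $M\subseteq C$.
   Context: $d^+(v,A)$ (resp. $d^-(v,A)$) is the number of outneighbours (resp. inneighbours) of $v$ in $A$. A tripartite digraph has its vertex set partitioned into three independent sets. A Hamilton cycle is a directed cycle through all vertices.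
   Formalization: The parameters $\varepsilon_0$ and $\varepsilon$ range over the rationals. -}

module Defs where

open import Data.Nat using (ℕ; zero; suc; _+_)
open import Data.Bool using (Bool; true; false; _∧_; if_then_else_)
open import Data.Fin using (Fin; zero; suc; toℕ)
open import Data.Fin.Properties using (_≟_)
open import Data.Product using (Σ; ∃; _×_; _,_)
open import Data.Sum using (_⊎_)
open import Data.Integer using (+_)
open import Data.Rational using (ℚ; _/_)
open import Relation.Nullary using (¬_)
open import Relation.Nullary.Decidable using (⌊_⌋)
open import Relation.Binary.PropositionalEquality using (_≡_)
open import Function.Definitions using (Injective)

ℕtoℚ : ℕ → ℚ
ℕtoℚ n = + n / 1

count : ∀ {N} → (Fin N → Bool) → ℕ
count {zero} p = 0
count {suc N} p = (if p zero then 1 else 0) + count {N} (λ i → p (suc i))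

-- Parts are indexed by Fin 3: zero = V₁, suc zero = V₂, suc (suc zero) = V₃.
-- cyclic successor / predecessor on part indices (i+1, i-1 modulo 3)
next3 : Fin 3 → Fin 3
next3 zero = suc zero
next3 (suc zero) = suc (suc zero)
next3 (suc (suc zero)) = zero

prev3 : Fin 3 → Fin 3
prev3 zero = suc (suc zero)
prev3 (suc zero) = zero
prev3 (suc (suc zero)) = suc zero

Tripartite : ∀ {N} → (Fin N → Fin N → Bool) → (Fin N → Fin 3) → Set
Tripartite {N} adj part = ∀ (u v : Fin N) → adj u v ≡ true → ¬ (part u ≡ part v)

partSize : ∀ {N} → (Fin N → Fin 3) → Fin 3 → ℕ
partSize part i = count (λ w → ⌊ part w ≟ i ⌋)

outdeg : ∀ {N} → (Fin N → Fin N → Bool) → (Fin N → Fin 3) → Fin N → Fin 3 → ℕ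
outdeg adj part v j = count (λ w → ⌊ part w ≟ j ⌋ ∧ adj v w)

indeg : ∀ {N} → (Fin N → Fin N → Bool) → (Fin N → Fin 3) → Fin N → Fin 3 → ℕ
indeg adj part v j = count (λ w → ⌊ part w ≟ j ⌋ ∧ adj w v)

CycSucc : ∀ {N} → Fin N → Fin N → Set
CycSucc {N} i j = (suc (toℕ i) ≡ toℕ j) ⊎ ((suc (toℕ i) ≡ N) × (toℕ j ≡ 0))

-- A Hamilton cycle: a cyclic ordering σ (bijection Fin N → Fin N, injective suffices
-- on a finite set) of all vertices, with an arc from each vertex to the next one.
record HamiltonCycle {N : ℕ} (adj : Fin N → Fin N → Bool) : Set where
  field
    σ      : Fin N → Fin N
    σ-inj  : Injective _≡_ _≡_ σ
    arcs   : ∀ i j → CycSucc i j → adj (σ i) (σ j) ≡ true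

InCycle : ∀ {N} {adj : Fin N → Fin N → Bool} → HamiltonCycle adj → Fin N → Fin N → Set
InCycle {N} C u v = ∃ λ (i : Fin N) → ∃ λ (j : Fin N) →
  CycSucc i j × (HamiltonCycle.σ C i ≡ u) × (HamiltonCycle.σ C j ≡ v)

record Matching {N : ℕ} (adj : Fin N → Fin N → Bool) (k : ℕ) : Set where
  field
    tail head : Fin k → Fin N
    isArc     : ∀ e → adj (tail e) (head e) ≡ true
    disjoint  : ∀ e f → ¬ (e ≡ f) →
                  ¬ (tail e ≡ tail f) × ¬ (tail e ≡ head f) ×
                  ¬ (head e ≡ tail f) × ¬ (head e ≡ head f)

module Submission where

-- The Hamilton cycle is built as a cyclic sequence of blocks a → b → c with a ∈ V₁, b ∈ V₂, c ∈ V₃,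
-- where a block may carry a matching edge t → h as a → b → t → h → c. Every vertex misses at most
-- n/100 vertices of the parts next to it, so while the cycle is short, fresh vertices with the
-- required arcs can be chosen greedily: first one carrying block per matching edge, then plain blocks.
-- Once the cycle has more than 7n/100 blocks, three unused vertices a′, b′, c′ are absorbed by
-- splitting a block y into a′ → b y → c′ and a y → b′ → ⋯ → c y; each of the six new arcs fails
-- for at most n/100 blocks, so some block works. With |V₁| blocks the cycle has 3|V₁| + 2k = N
-- distinct vertices, hence is Hamiltonian.

open import Defs
open import Data.Bool using (Bool)
open import Data.Fin using (Fin)
open import Data.Nat using (ℕ)

module Counting where
  open import Data.Bool using (Bool; true; false; _∧_; _∨_; not; if_then_else_)
  open import Data.Bool.ListAction using (all)
  open import Data.Bool.Properties using (∧-identityʳ; ∧-zeroʳ; ∧-distribˡ-∨)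
  open import Data.Empty using (⊥-elim)
  open import Data.Fin using (Fin; zero; suc)
  open import Data.Fin.Properties using (_≟_)
  open import Data.List using (List; []; _∷_; _++_; length; map; tabulate)
  open import Data.List.Membership.Propositional using (_∈_)
  open import Data.List.Relation.Unary.All using (All; []; _∷_)
  open import Data.List.Relation.Unary.Any using (here; there)
  open import Data.Nat using (ℕ; zero; suc; _+_; _≤_; _<_; z≤n; s≤s)
  open import Data.Nat.Properties hiding (_≟_)
  open import Algebra.Properties.CommutativeSemigroup +-commutativeSemigroup
    using () renaming (interchange to +-interchange; x∙yz≈y∙xz to +-comm-middle)
  open import Data.Product using (Σ; _×_; _,_)
  open import Data.Sum using (_⊎_; inj₁; inj₂)
  open import Function using (_∘_)
  open import Relation.Nullary using (¬_)
  open import Relation.Nullary.Decidable using (⌊_⌋)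
  open import Relation.Binary.PropositionalEquality

  𝟙 : Bool → ℕ
  𝟙 b = if b then 1 else 0

  𝟙≤1 : ∀ b → 𝟙 b ≤ 1
  𝟙≤1 true = ≤-refl
  𝟙≤1 false = z≤n

  ∧-true⇒ : ∀ {a b} → a ∧ b ≡ true → (a ≡ true) × (b ≡ true)
  ∧-true⇒ {true} {true} _ = refl , refl

  positive : ℕ → Bool
  positive zero = false
  positive (suc _) = true

  ¬positive⇒≡0 : ∀ m → not (positive m) ≡ true → m ≡ 0
  ¬positive⇒≡0 zero _ = refl

  all≡true⇒All : ∀ {A : Set} (f : A → Bool) ys → all f ys ≡ true → All (λ y → f y ≡ true) ys
  all≡true⇒All f [] _ = []
  all≡true⇒All f (y ∷ ys) h with f y in fy
  ... | true = fy ∷ all≡true⇒All f ys h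

  count-cong : ∀ {N} {p q : Fin N → Bool} → (∀ v → p v ≡ q v) → count p ≡ count q
  count-cong {zero} e = refl
  count-cong {suc N} e = cong₂ _+_ (cong 𝟙 (e zero)) (count-cong (e ∘ suc))

  count-mono : ∀ {N} {p q : Fin N → Bool} → (∀ v → p v ≡ true → q v ≡ true) → count p ≤ count q
  count-mono {zero} h = z≤n
  count-mono {suc N} {p} {q} h = +-mono-≤ (𝟙-mono (p zero) (q zero) (h zero)) (count-mono (h ∘ suc))
    where
    𝟙-mono : ∀ a b → (a ≡ true → b ≡ true) → 𝟙 a ≤ 𝟙 b
    𝟙-mono true b f rewrite f refl = ≤-refl
    𝟙-mono false b f = z≤n

  count-split : ∀ {N} (q r : Fin N → Bool) →
    count q ≡ count (λ v → q v ∧ not (r v)) + count (λ v → q v ∧ r v)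
  count-split {zero} q r = refl
  count-split {suc N} q r =
    trans (cong₂ _+_ (𝟙-split (q zero) (r zero)) (count-split (q ∘ suc) (r ∘ suc)))
          (+-interchange (𝟙 (q zero ∧ not (r zero))) (𝟙 (q zero ∧ r zero))
                         (count (λ v → q (suc v) ∧ not (r (suc v)))) (count (λ v → q (suc v) ∧ r (suc v))))
    where
    𝟙-split : ∀ a b → 𝟙 a ≡ 𝟙 (a ∧ not b) + 𝟙 (a ∧ b)
    𝟙-split true true = refl
    𝟙-split true false = refl
    𝟙-split false b = refl

  count-∨ : ∀ {N} (p q : Fin N → Bool) → count (λ v → p v ∨ q v) ≤ count p + count q
  count-∨ {zero} p q = z≤n
  count-∨ {suc N} p q =
    ≤-trans (+-mono-≤ (𝟙-∨ (p zero) (q zero)) (count-∨ (p ∘ suc) (q ∘ suc)))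
            (≤-reflexive (+-interchange (𝟙 (p zero)) (𝟙 (q zero)) (count (p ∘ suc)) (count (q ∘ suc))))
    where
    𝟙-∨ : ∀ a b → 𝟙 (a ∨ b) ≤ 𝟙 a + 𝟙 b
    𝟙-∨ true b = s≤s z≤n
    𝟙-∨ false b = ≤-refl

  count-const-false : ∀ {N} → count {N} (λ _ → false) ≡ 0
  count-const-false {zero} = refl
  count-const-false {suc N} = count-const-false {N}

  count-const-true : ∀ {N} → count {N} (λ _ → true) ≡ N
  count-const-true {zero} = refl
  count-const-true {suc N} = cong suc (count-const-true {N})

  count-witness : ∀ {N} (p : Fin N → Bool) → 0 < count p → Σ (Fin N) λ v → p v ≡ true
  count-witness {suc N} p pos with p zero in eq
  ... | true = zero , eq
  ... | false with count-witness (p ∘ suc) pos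
  ... | v , pv = suc v , pv

  partSizes-sum : ∀ {N} (part : Fin N → Fin 3) →
    partSize part zero + (partSize part (suc zero) + partSize part (suc (suc zero))) ≡ N
  partSizes-sum {zero} part = refl
  partSizes-sum {suc N} part =
    trans (+-interchange-3 (𝟙 (in-part zero)) (𝟙 (in-part (suc zero))) (𝟙 (in-part (suc (suc zero))))
            (partSize (part ∘ suc) zero) (partSize (part ∘ suc) (suc zero)) (partSize (part ∘ suc) (suc (suc zero))))
          (cong₂ _+_ (one-part (part zero)) (partSizes-sum (part ∘ suc)))
    where
    in-part : Fin 3 → Bool
    in-part P = ⌊ part zero ≟ P ⌋
    one-part : ∀ x → 𝟙 ⌊ x ≟ zero ⌋ + (𝟙 ⌊ x ≟ suc zero ⌋ + 𝟙 ⌊ x ≟ suc (suc zero) ⌋) ≡ 1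
    one-part zero = refl
    one-part (suc zero) = refl
    one-part (suc (suc zero)) = refl
    +-interchange-3 : ∀ a₁ a₂ a₃ A₁ A₂ A₃ → (a₁ + A₁) + ((a₂ + A₂) + (a₃ + A₃)) ≡ (a₁ + (a₂ + a₃)) + (A₁ + (A₂ + A₃))
    +-interchange-3 a₁ a₂ a₃ A₁ A₂ A₃ =
      trans (cong ((a₁ + A₁) +_) (+-interchange a₂ A₂ a₃ A₃)) (+-interchange a₁ A₁ (a₂ + a₃) (A₂ + A₃))

  -- Unlike ⌊ _≟_ ⌋, this reduces by pattern matching on both arguments.
  _==_ : ∀ {N} → Fin N → Fin N → Bool
  zero == zero = true
  zero == suc _ = false
  suc _ == zero = false
  suc i == suc j = i == j

  ==-refl : ∀ {N} (x : Fin N) → (x == x) ≡ true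
  ==-refl zero = refl
  ==-refl (suc x) = ==-refl x

  ==⇒≡ : ∀ {N} (x y : Fin N) → (x == y) ≡ true → x ≡ y
  ==⇒≡ zero zero _ = refl
  ==⇒≡ (suc x) (suc y) e = cong suc (==⇒≡ x y e)

  ≢⇒==-false : ∀ {N} (x y : Fin N) → ¬ (x ≡ y) → (x == y) ≡ false
  ≢⇒==-false x y x≢y with x == y in eq
  ... | true = ⊥-elim (x≢y (==⇒≡ x y eq))
  ... | false = refl

  count-at : ∀ {N} (p : Fin N → Bool) (x : Fin N) → count (λ v → p v ∧ (v == x)) ≡ 𝟙 (p x)
  count-at {suc N} p zero rewrite ∧-identityʳ (p zero) =
    trans (cong (𝟙 (p zero) +_) none) (+-identityʳ (𝟙 (p zero)))
    where
    none : count (λ v → p (suc v) ∧ false) ≡ 0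
    none = trans (count-cong (λ v → ∧-zeroʳ (p (suc v)))) (count-const-false {N})
  count-at {suc N} p (suc x) rewrite ∧-zeroʳ (p zero) = count-at (p ∘ suc) x

  count-remove : ∀ {N} (Q : Fin N → Bool) (x : Fin N) → Q x ≡ true →
    count Q ≡ suc (count (λ v → Q v ∧ not (v == x)))
  count-remove Q x Qx = begin
    count Q                                 ≡⟨ count-split Q (_== x) ⟩
    rest + count (λ v → Q v ∧ (v == x))     ≡⟨ cong (rest +_) (trans (count-at Q x) (cong 𝟙 Qx)) ⟩
    rest + 1                                ≡⟨ +-comm rest 1 ⟩
    suc rest                                ∎
    where
    open ≡-Reasoning
    rest = count (λ v → Q v ∧ not (v == x))

  occ : ∀ {N} → Fin N → List (Fin N) → ℕ
  occ v [] = 0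
  occ v (x ∷ xs) = 𝟙 (v == x) + occ v xs

  Distinct : ∀ {N} → List (Fin N) → Set
  Distinct L = ∀ v → occ v L ≤ 1

  countL : ∀ {A : Set} → (A → Bool) → List A → ℕ
  countL p [] = 0
  countL p (x ∷ xs) = 𝟙 (p x) + countL p xs

  occ-++ : ∀ {N} (v : Fin N) xs ys → occ v (xs ++ ys) ≡ occ v xs + occ v ys
  occ-++ v [] ys = refl
  occ-++ v (x ∷ xs) ys = trans (cong (𝟙 (v == x) +_) (occ-++ v xs ys)) (sym (+-assoc (𝟙 (v == x)) _ _))

  occ-middle : ∀ {N} (v : Fin N) xs ys zs → occ v (xs ++ (ys ++ zs)) ≡ occ v ys + occ v (xs ++ zs)
  occ-middle v xs ys zs = begin
    occ v (xs ++ (ys ++ zs))          ≡⟨ occ-++ v xs (ys ++ zs) ⟩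
    occ v xs + occ v (ys ++ zs)       ≡⟨ cong (occ v xs +_) (occ-++ v ys zs) ⟩
    occ v xs + (occ v ys + occ v zs)  ≡⟨ +-comm-middle (occ v xs) (occ v ys) (occ v zs) ⟩
    occ v ys + (occ v xs + occ v zs)  ≡⟨ cong (occ v ys +_) (occ-++ v xs zs) ⟨
    occ v ys + occ v (xs ++ zs)       ∎
    where
    open ≡-Reasoning

  occ-++-shift : ∀ {N} (v : Fin N) xs {ys zs} d → occ v ys ≡ d + occ v zs → occ v (xs ++ ys) ≡ d + occ v (xs ++ zs)
  occ-++-shift v [] d eq = eq
  occ-++-shift v (x ∷ xs) {ys} {zs} d eq = begin
    𝟙 (v == x) + occ v (xs ++ ys)         ≡⟨ cong (𝟙 (v == x) +_) (occ-++-shift v xs d eq) ⟩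
    𝟙 (v == x) + (d + occ v (xs ++ zs))   ≡⟨ +-comm-middle (𝟙 (v == x)) d (occ v (xs ++ zs)) ⟩
    d + (𝟙 (v == x) + occ v (xs ++ zs))   ∎
    where open ≡-Reasoning

  occ-++≡0ˡ : ∀ {N} (v : Fin N) xs ys → occ v (xs ++ ys) ≡ 0 → occ v xs ≡ 0
  occ-++≡0ˡ v xs ys e = m+n≡0⇒m≡0 (occ v xs) (trans (sym (occ-++ v xs ys)) e)

  occ-++≡0ʳ : ∀ {N} (v : Fin N) xs ys → occ v (xs ++ ys) ≡ 0 → occ v ys ≡ 0
  occ-++≡0ʳ v xs ys e = m+n≡0⇒n≡0 (occ v xs) (trans (sym (occ-++ v xs ys)) e)

  occ-at : ∀ {N} (v : Fin N) xs ys → 1 ≤ occ v (xs ++ v ∷ ys)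
  occ-at v [] ys rewrite ==-refl v = s≤s z≤n
  occ-at v (x ∷ xs) ys = ≤-trans (occ-at v xs ys) (m≤n+m _ (𝟙 (v == x)))

  occ-tabulate : ∀ {N k} (f : Fin k → Fin N) e → 1 ≤ occ (f e) (tabulate f)
  occ-tabulate {k = suc k} f zero rewrite ==-refl (f zero) = s≤s z≤n
  occ-tabulate {k = suc k} f (suc e) = ≤-trans (occ-tabulate (f ∘ suc) e) (m≤n+m _ (𝟙 (f (suc e) == f zero)))

  occ⇒∈ : ∀ {N} {x : Fin N} xs → 1 ≤ occ x xs → x ∈ xs
  occ⇒∈ {x = x} (y ∷ ys) p with x == y in eq
  ... | true = here (==⇒≡ x y eq)
  ... | false = there (occ⇒∈ ys p)

  1≤+⇒ : ∀ m {n} → 1 ≤ m + n → 1 ≤ m ⊎ 1 ≤ n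
  1≤+⇒ zero p = inj₂ p
  1≤+⇒ (suc m) _ = inj₁ (s≤s z≤n)

  absent : ∀ {N} {x : Fin N} {xs} → All (λ y → ¬ x ≡ y) xs → occ x xs ≡ 0
  absent {x = x} {[]} [] = refl
  absent {x = x} {y ∷ ys} (x≢y ∷ rest) rewrite ≢⇒==-false x y x≢y = absent rest

  absent≢present : ∀ {N} {x y : Fin N} xs → occ x xs ≡ 0 → 1 ≤ occ y xs → ¬ x ≡ y
  absent≢present xs x∉ y∈ refl rewrite x∉ = <-irrefl refl y∈

  absent-from-members : ∀ {N} {old : List (Fin N)} ys → All (λ u → occ u old ≡ 0) ys →
    ∀ v → 1 ≤ occ v ys → occ v old ≡ 0
  absent-from-members {old = old} (y ∷ ys) (y∉ ∷ ys∉) v v∈ with v == y in eq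
  ... | true rewrite ==⇒≡ v y eq = y∉
  ... | false = absent-from-members {old = old} ys ys∉ v v∈

  distinct-tail : ∀ {N} (x : Fin N) xs → Distinct (x ∷ xs) → Distinct xs
  distinct-tail x xs d v = ≤-trans (m≤n+m _ (𝟙 (v == x))) (d v)

  distinct-head : ∀ {N} (x : Fin N) xs → Distinct (x ∷ xs) → occ x xs ≡ 0
  distinct-head x xs d with d x
  ... | le rewrite ==-refl x = n≤0⇒n≡0 (≤-pred le)

  distinct-cons : ∀ {N} {x : Fin N} {xs} → All (λ y → ¬ x ≡ y) xs → Distinct xs → Distinct (x ∷ xs)
  distinct-cons {x = x} {xs} x≢xs d v with v == x in eq
  ... | false = d v
  ... | true rewrite ==⇒≡ v x eq | absent x≢xs = ≤-refl

  distinct-merge : ∀ {N} {old new : List (Fin N)} ys → Distinct old → Distinct ys →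
    (∀ v → 1 ≤ occ v ys → occ v old ≡ 0) → (∀ v → occ v new ≡ occ v ys + occ v old) → Distinct new
  distinct-merge {old = old} ys d-old d-ys fresh split v rewrite split v with occ v ys in eq
  ... | zero = d-old v
  ... | suc m rewrite fresh v (subst (1 ≤_) (sym eq) (s≤s z≤n)) | +-identityʳ (suc m) = subst (_≤ 1) eq (d-ys v)

  countL≤length : ∀ {A : Set} (p : A → Bool) xs → countL p xs ≤ length xs
  countL≤length p [] = z≤n
  countL≤length p (x ∷ xs) = +-mono-≤ (𝟙≤1 (p x)) (countL≤length p xs)

  countL-++ : ∀ {A : Set} (p : A → Bool) xs ys → countL p (xs ++ ys) ≡ countL p xs + countL p ys
  countL-++ p [] ys = refl
  countL-++ p (x ∷ xs) ys = trans (cong (𝟙 (p x) +_) (countL-++ p xs ys)) (sym (+-assoc (𝟙 (p x)) _ _))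

  countL-map : ∀ {A B : Set} (p : B → Bool) (f : A → B) xs → countL (p ∘ f) xs ≡ countL p (map f xs)
  countL-map p f [] = refl
  countL-map p f (x ∷ xs) = cong (𝟙 (p (f x)) +_) (countL-map p f xs)

  countL-not-∧ : ∀ {A : Set} (p q : A → Bool) xs →
    countL (λ x → not (p x ∧ q x)) xs ≤ countL (λ x → not (p x)) xs + countL (λ x → not (q x)) xs
  countL-not-∧ p q [] = z≤n
  countL-not-∧ p q (x ∷ xs) =
    ≤-trans (+-mono-≤ (𝟙-not-∧ (p x) (q x)) (countL-not-∧ p q xs))
            (≤-reflexive (+-interchange (𝟙 (not (p x))) (𝟙 (not (q x))) (countL (λ x → not (p x)) xs) (countL (λ x → not (q x)) xs)))
    where
    𝟙-not-∧ : ∀ a b → 𝟙 (not (a ∧ b)) ≤ 𝟙 (not a) + 𝟙 (not b)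
    𝟙-not-∧ true true = z≤n
    𝟙-not-∧ true false = ≤-refl
    𝟙-not-∧ false b = s≤s z≤n

  length≡countL+countL-not : ∀ {A : Set} (p : A → Bool) xs → length xs ≡ countL p xs + countL (λ x → not (p x)) xs
  length≡countL+countL-not p [] = refl
  length≡countL+countL-not p (x ∷ xs) with p x
  ... | true = cong suc (length≡countL+countL-not p xs)
  ... | false = trans (cong suc (length≡countL+countL-not p xs)) (sym (+-suc _ _))

  count-occurring≤countL : ∀ {N} (p : Fin N → Bool) F → count (λ v → p v ∧ positive (occ v F)) ≤ countL p F
  count-occurring≤countL {N} p [] =
    ≤-reflexive (trans (count-cong (λ v → ∧-zeroʳ (p v))) (count-const-false {N}))
  count-occurring≤countL p (x ∷ F) = begin
    count (λ v → p v ∧ positive (𝟙 (v == x) + occ v F))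
      ≡⟨ count-cong (λ v → trans (cong (p v ∧_) (positive-+ (v == x) (occ v F))) (∧-distribˡ-∨ (p v) _ _)) ⟩
    count (λ v → (p v ∧ (v == x)) ∨ (p v ∧ positive (occ v F)))
      ≤⟨ count-∨ (λ v → p v ∧ (v == x)) (λ v → p v ∧ positive (occ v F)) ⟩
    count (λ v → p v ∧ (v == x)) + count (λ v → p v ∧ positive (occ v F))
      ≤⟨ +-mono-≤ (≤-reflexive (count-at p x)) (count-occurring≤countL p F) ⟩
    𝟙 (p x) + countL p F ∎
    where
    open ≤-Reasoning
    positive-+ : ∀ b m → positive (𝟙 b + m) ≡ b ∨ positive m
    positive-+ true m = refl
    positive-+ false m = refl

  occ≡0⇒All≢ : ∀ {N} {A : Set} (f : A → Fin N) (v : Fin N) ws → occ v (map f ws) ≡ 0 → All (λ w → (f w == v) ≡ false) ws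
  occ≡0⇒All≢ f v [] _ = []
  occ≡0⇒All≢ f v (w ∷ ws) h with v == f w in eq
  ... | false = trans (==-sym (f w) v) eq ∷ occ≡0⇒All≢ f v ws h
    where
    ==-sym : ∀ {N} (x y : Fin N) → (x == y) ≡ (y == x)
    ==-sym zero zero = refl
    ==-sym zero (suc y) = refl
    ==-sym (suc x) zero = refl
    ==-sym (suc x) (suc y) = ==-sym x y

  countL≤count : ∀ {N} {A : Set} (f : A → Fin N) (P : A → Bool) (Q : Fin N → Bool) xs →
    Distinct (map f xs) → All (λ w → P w ≡ true → Q (f w) ≡ true) xs → countL P xs ≤ count Q
  countL≤count f P Q [] _ _ = z≤n
  countL≤count f P Q (w ∷ ws) d (Pw⇒ ∷ Ps⇒) with P w in Pw
  ... | false = countL≤count f P Q ws (distinct-tail (f w) (map f ws) d) Ps⇒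
  ... | true = begin
    suc (countL P ws)   ≤⟨ s≤s (countL≤count f P Q′ ws (distinct-tail (f w) (map f ws) d) (restrict ws Ps⇒ others≢)) ⟩
    suc (count Q′)      ≡⟨ count-remove Q (f w) (Pw⇒ refl) ⟨
    count Q             ∎
    where
    open ≤-Reasoning
    others≢ : All (λ y → (f y == f w) ≡ false) ws
    others≢ = occ≡0⇒All≢ f (f w) ws (distinct-head (f w) (map f ws) d)
    Q′ : Fin _ → Bool
    Q′ v = Q v ∧ not (v == f w)
    restrict : ∀ ys → All (λ y → P y ≡ true → Q (f y) ≡ true) ys → All (λ y → (f y == f w) ≡ false) ys →
               All (λ y → P y ≡ true → Q′ (f y) ≡ true) ys
    restrict [] _ _ = []
    restrict (y ∷ ys) (q ∷ qs) (ne ∷ nes) = (λ Py → ∧-not (q Py) ne) ∷ restrict ys qs nes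
      where
      ∧-not : ∀ {a b} → a ≡ true → b ≡ false → a ∧ not b ≡ true
      ∧-not refl refl = refl


module ClosedWalk {N : ℕ} (adj : Fin N → Fin N → Bool) where
  open import Data.Bool using (Bool; true)
  open import Data.Empty using (⊥-elim)
  open import Data.Fin using (Fin; zero; suc; toℕ; cast)
  open import Data.Fin.Properties using (toℕ-injective; toℕ-cast)
  open import Data.List using (List; []; _∷_; _++_; length; lookup)
  open import Data.Nat using (ℕ; zero; suc; _≤_; z≤n; s≤s)
  open import Data.Nat.Properties using (≤-trans; m≤n+m; <-irrefl; suc-injective)
  open import Data.Product using (Σ; _×_; _,_)
  open import Data.Sum using (inj₁; inj₂)
  open import Relation.Binary.PropositionalEquality
  open Counting

  Walk : Fin N → List (Fin N) → Fin N → Set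
  Walk u [] w = adj u w ≡ true
  Walk u (x ∷ xs) w = adj u x ≡ true × Walk x xs w

  walk-step : ∀ {u xs w} → Walk u xs w → (i j : Fin (suc (length xs))) → suc (toℕ i) ≡ toℕ j →
              adj (lookup (u ∷ xs) i) (lookup (u ∷ xs) j) ≡ true
  walk-step {xs = x ∷ xs} (ux , _) zero (suc zero) _ = ux
  walk-step {xs = x ∷ xs} (_ , wk) (suc i) (suc j) e = walk-step wk i j (suc-injective e)

  walk-last : ∀ {u xs w} → Walk u xs w → (i : Fin (suc (length xs))) → toℕ i ≡ length xs →
              adj (lookup (u ∷ xs) i) w ≡ true
  walk-last {xs = []} uw zero _ = uw
  walk-last {xs = x ∷ xs} (_ , wk) (suc i) e = walk-last wk i (suc-injective e)

  occ-lookup : ∀ (L : List (Fin N)) i → 1 ≤ occ (lookup L i) L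
  occ-lookup (x ∷ L) zero rewrite ==-refl x = s≤s z≤n
  occ-lookup (x ∷ L) (suc i) = ≤-trans (occ-lookup L i) (m≤n+m _ (𝟙 (lookup L i == x)))

  lookup-injective : ∀ (L : List (Fin N)) → Distinct L → ∀ i j → lookup L i ≡ lookup L j → i ≡ j
  lookup-injective (x ∷ L) d zero zero _ = refl
  lookup-injective (x ∷ L) d zero (suc j) e =
    ⊥-elim (<-irrefl (sym (distinct-head x L d)) (subst (λ v → 1 ≤ occ v L) (sym e) (occ-lookup L j)))
  lookup-injective (x ∷ L) d (suc i) zero e =
    ⊥-elim (<-irrefl (sym (distinct-head x L d)) (subst (λ v → 1 ≤ occ v L) e (occ-lookup L i)))
  lookup-injective (x ∷ L) d (suc i) (suc j) e = cong suc (lookup-injective L (distinct-tail x L d) i j e)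

  Consecutive : Fin N → Fin N → List (Fin N) → Set
  Consecutive x y L = Σ (Fin (length L)) λ i → Σ (Fin (length L)) λ j →
    (suc (toℕ i) ≡ toℕ j) × (lookup L i ≡ x) × (lookup L j ≡ y)

  consecutive : ∀ pre x y post → Consecutive x y (pre ++ x ∷ y ∷ post)
  consecutive [] x y post = zero , suc zero , refl , refl , refl
  consecutive (_ ∷ pre) x y post with consecutive pre x y post
  ... | i , j , e , ex , ey = suc i , suc j , cong suc e , ex , ey

  hamiltonCycle : ∀ u xs → length (u ∷ xs) ≡ N → Distinct (u ∷ xs) → Walk u xs u →
    Σ (HamiltonCycle adj) λ C → ∀ pre x y post → u ∷ xs ≡ pre ++ x ∷ y ∷ post → InCycle C x y
  hamiltonCycle u xs len d wk = C , onCycle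
    where
    L = u ∷ xs
    ι : Fin N → Fin (length L)
    ι = cast (sym len)
    toℕ-ι : ∀ i → toℕ (ι i) ≡ toℕ i
    toℕ-ι = toℕ-cast (sym len)
    σ : Fin N → Fin N
    σ i = lookup L (ι i)
    arcs : ∀ i j → CycSucc i j → adj (σ i) (σ j) ≡ true
    arcs i j (inj₁ e) = walk-step wk (ι i) (ι j) (trans (cong suc (toℕ-ι i)) (trans e (sym (toℕ-ι j))))
    arcs i j (inj₂ (last , j≡0)) =
      subst (λ z → adj (σ i) (lookup L z) ≡ true) (sym (toℕ-injective (trans (toℕ-ι j) j≡0)))
        (walk-last wk (ι i) (suc-injective (trans (cong suc (toℕ-ι i)) (trans last (sym len)))))
    C : HamiltonCycle adj
    C = record
      { σ = σ
      ; σ-inj = λ {i} {j} e → toℕ-injective (trans (sym (toℕ-ι i)) (trans (cong toℕ (lookup-injective L d _ _ e)) (toℕ-ι j)))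
      ; arcs = arcs
      }
    onCycle : ∀ pre x y post → L ≡ pre ++ x ∷ y ∷ post → InCycle C x y
    onCycle pre x y post eq with subst (Consecutive x y) (sym eq) (consecutive pre x y post)
    ... | i , j , e , ex , ey = cast len i , cast len j ,
          inj₁ (trans (cong suc (toℕ-cast len i)) (trans e (sym (toℕ-cast len j)))) ,
          trans (cong (lookup L) (ι∘cast i)) ex , trans (cong (lookup L) (ι∘cast j)) ey
      where
      ι∘cast : ∀ i → ι (cast len i) ≡ i
      ι∘cast i = toℕ-injective (trans (toℕ-ι (cast len i)) (toℕ-cast len i))


module Construction where
  open import Data.Bool using (Bool; true; false; _∧_; not)
  open import Data.Bool.Properties using (∧-assoc; ∧-identityʳ)
  open import Function using (_∘_)
  open import Data.Empty using (⊥; ⊥-elim)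
  open import Data.Maybe using (Maybe; just; nothing; is-just)
  open import Data.Unit using (⊤; tt)
  open import Data.Fin using (Fin; zero; suc; toℕ; fromℕ<)
  open import Data.Fin.Properties using (_≟_; toℕ-fromℕ<; toℕ-injective; toℕ<n)
  open import Data.Bool.ListAction using (all)
  open import Data.List using (List; []; _∷_; _++_; length; map; tabulate; concatMap)
  open import Data.List.Properties using (length-++; length-tabulate; concatMap-++; ++-identityʳ; ++-assoc)
  open import Data.List.Relation.Unary.All using (All; []; _∷_)
  import Data.List.Relation.Unary.All as All
  open import Data.List.Relation.Unary.All.Properties using (++⁺; ++⁻)
  open import Data.List.Relation.Unary.Any using (Any; here; there)
  open import Data.List.Membership.Propositional using (_∈_)
  open import Data.Nat using (ℕ; zero; suc; _+_; _*_; _∸_; _≤_; _<_; _≤?_; z≤n; s≤s)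
  open import Data.Nat.Properties hiding (_≟_)
  open import Data.Nat.Properties using () renaming (_≟_ to _≟ℕ_)
  open import Data.Nat.Tactic.RingSolver using (solve-∀)
  open import Data.Product using (Σ; _×_; _,_; proj₁; proj₂)
  open import Data.Sum using (_⊎_; inj₁; inj₂)
  open import Relation.Nullary using (¬_; Dec; yes; no)
  open import Relation.Nullary.Decidable using (⌊_⌋)
  open import Relation.Binary.PropositionalEquality
  open Counting

  V₁ V₂ V₃ : Fin 3
  V₁ = zero
  V₂ = suc zero
  V₃ = suc (suc zero)


  module _
    {N : ℕ} (adj : Fin N → Fin N → Bool) (part : Fin N → Fin 3) (n k : ℕ) (M : Matching adj k)
    (M-parts : ∀ e → (part (Matching.tail M e) ≡ V₃) × (part (Matching.head M e) ≡ V₂))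
    (|V₁|+k≡n : partSize part V₁ + k ≡ n) (|V₂|≡n : partSize part V₂ ≡ n) (|V₃|≡n : partSize part V₃ ≡ n)
    (100k≤n : 100 * k ≤ n) (100≤n : 100 ≤ n)
    (few-non-out : ∀ v → 100 * count (λ w → ⌊ part w ≟ next3 (part v) ⌋ ∧ not (adj v w)) ≤ n)
    (few-non-in : ∀ v → 100 * count (λ w → ⌊ part w ≟ prev3 (part v) ⌋ ∧ not (adj w v)) ≤ n)
    where

    open Matching M using (tail; head; isArc; disjoint)
    open ClosedWalk adj using (Walk; hamiltonCycle)

    _∈ₚ_ : Fin N → Fin 3 → Bool
    v ∈ₚ P = ⌊ part v ≟ P ⌋

    ∈ₚ⇒ : ∀ {v P} → (v ∈ₚ P) ≡ true → part v ≡ P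
    ∈ₚ⇒ {v} {P} e with part v ≟ P
    ... | yes p = p

    ⇒∈ₚ : ∀ {v P} → part v ≡ P → (v ∈ₚ P) ≡ true
    ⇒∈ₚ {v} {P} p with part v ≟ P
    ... | yes _ = refl
    ... | no ¬p = ⊥-elim (¬p p)

    -- Greedy choice of fresh vertices

    NonNeighbours : Fin 3 → (Fin N → Fin N → Bool) → Fin N → ℕ
    NonNeighbours P g y = count (λ v → (v ∈ₚ P) ∧ not (g v y))

    count-∧-all : (P : Fin 3) (g : Fin N → Fin N → Bool) (q : Fin N → Bool) (ys : List (Fin N)) →
      (∀ v → q v ≡ true → (v ∈ₚ P) ≡ true) → All (λ y → 100 * NonNeighbours P g y ≤ n) ys →
      100 * count q ≤ 100 * count (λ v → q v ∧ all (g v) ys) + n * length ys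
    count-∧-all P g q [] _ _ =
      ≤-reflexive (begin-equality
        100 * count q                            ≡⟨ cong (100 *_) (count-cong (λ v → sym (∧-identityʳ (q v)))) ⟩
        100 * count (λ v → q v ∧ true)           ≡⟨ +-identityʳ _ ⟨
        100 * count (λ v → q v ∧ true) + 0       ≡⟨ cong (100 * count (λ v → q v ∧ true) +_) (*-zeroʳ n) ⟨
        100 * count (λ v → q v ∧ true) + n * 0   ∎)
      where open ≤-Reasoning
    count-∧-all P g q (y ∷ ys) q⇒P (few ∷ fews) = begin
      100 * count q
        ≡⟨ cong (100 *_) (count-split q (λ v → g v y)) ⟩
      100 * (count (λ v → q v ∧ not (g v y)) + count q′)
        ≤⟨ *-monoʳ-≤ 100 (+-monoˡ-≤ _ (count-mono missed)) ⟩
      100 * (NonNeighbours P g y + count q′)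
        ≡⟨ *-distribˡ-+ 100 (NonNeighbours P g y) _ ⟩
      100 * NonNeighbours P g y + 100 * count q′
        ≤⟨ +-mono-≤ few (count-∧-all P g q′ ys (λ v → q⇒P v ∘ proj₁ ∘ ∧-true⇒) fews) ⟩
      n + (100 * count (λ v → q′ v ∧ all (g v) ys) + n * length ys)
        ≡⟨ cong (λ c → n + (100 * c + n * length ys)) (count-cong (λ v → ∧-assoc (q v) (g v y) _)) ⟩
      n + (100 * count (λ v → q v ∧ all (g v) (y ∷ ys)) + n * length ys)
        ≡⟨ rearrange n (count (λ v → q v ∧ all (g v) (y ∷ ys))) (length ys) ⟩
      100 * count (λ v → q v ∧ all (g v) (y ∷ ys)) + n * length (y ∷ ys) ∎
      where
      open ≤-Reasoning
      q′ : Fin N → Bool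
      q′ v = q v ∧ g v y
      missed : ∀ v → q v ∧ not (g v y) ≡ true → (v ∈ₚ P) ∧ not (g v y) ≡ true
      missed v e with ∧-true⇒ {q v} e
      ... | qv , ¬g rewrite q⇒P v qv | ¬g = refl
      rearrange : ∀ n c l → n + (100 * c + n * l) ≡ 100 * c + n * suc l
      rearrange = solve-∀

    Candidate : Fin 3 → (F ins outs : List (Fin N)) → Fin N → Bool
    Candidate P F ins outs v =
      (((v ∈ₚ P) ∧ not (positive (occ v F))) ∧ all (λ y → adj y v) ins) ∧ all (adj v) outs

    candidates-many : ∀ P F ins outs → All (λ y → next3 (part y) ≡ P) ins → All (λ z → prev3 (part z) ≡ P) outs →
      100 * partSize part P ≤ 100 * count (Candidate P F ins outs) + (n * (length ins + length outs) + 100 * length F)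
    candidates-many P F ins outs ins→P outs→P = begin
      100 * count (_∈ₚ P)
        ≡⟨ cong (100 *_) (count-split (_∈ₚ P) (λ v → positive (occ v F))) ⟩
      100 * (count fresh + count (λ v → (v ∈ₚ P) ∧ positive (occ v F)))
        ≤⟨ *-monoʳ-≤ 100 (+-monoʳ-≤ (count fresh) (≤-trans (count-occurring≤countL (_∈ₚ P) F) (countL≤length _ F))) ⟩
      100 * (count fresh + length F)
        ≡⟨ *-distribˡ-+ 100 (count fresh) (length F) ⟩
      100 * count fresh + 100 * length F
        ≤⟨ +-monoˡ-≤ _ (count-∧-all P (λ v y → adj y v) fresh ins (λ v → proj₁ ∘ ∧-true⇒) (few-in ins ins→P)) ⟩
      100 * count fresh-from + n * length ins + 100 * length F
        ≤⟨ +-monoˡ-≤ _ (+-monoˡ-≤ _ (count-∧-all P (λ v z → adj v z) fresh-from outs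
                          (λ v → proj₁ ∘ ∧-true⇒ ∘ proj₁ ∘ ∧-true⇒) (few-out outs outs→P))) ⟩
      100 * count (Candidate P F ins outs) + n * length outs + n * length ins + 100 * length F
        ≡⟨ rearrange (100 * count (Candidate P F ins outs)) n (length ins) (length outs) (100 * length F) ⟩
      100 * count (Candidate P F ins outs) + (n * (length ins + length outs) + 100 * length F) ∎
      where
      open ≤-Reasoning
      fresh fresh-from : Fin N → Bool
      fresh v = (v ∈ₚ P) ∧ not (positive (occ v F))
      fresh-from v = fresh v ∧ all (λ y → adj y v) ins
      few-in : ∀ ys → All (λ y → next3 (part y) ≡ P) ys → All (λ y → 100 * NonNeighbours P (λ v y → adj y v) y ≤ n) ys
      few-in [] [] = []
      few-in (y ∷ ys) (e ∷ es) = subst (λ Q → 100 * NonNeighbours Q (λ v y → adj y v) y ≤ n) e (few-non-out y) ∷ few-in ys es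
      few-out : ∀ zs → All (λ z → prev3 (part z) ≡ P) zs → All (λ z → 100 * NonNeighbours P (λ v z → adj v z) z ≤ n) zs
      few-out [] [] = []
      few-out (z ∷ zs) (e ∷ es) = subst (λ Q → 100 * NonNeighbours Q (λ v z → adj v z) z ≤ n) e (few-non-in z) ∷ few-out zs es
      rearrange : ∀ c n i o f → c + n * o + n * i + f ≡ c + (n * (i + o) + f)
      rearrange = solve-∀

    99n≤100|V| : ∀ P → 99 * n ≤ 100 * partSize part P
    99n≤100|V| zero = +-cancelʳ-≤ n (99 * n) (100 * partSize part V₁) (begin
      99 * n + n                                  ≡⟨ +-comm (99 * n) n ⟩
      100 * n                                     ≡⟨ cong (100 *_) |V₁|+k≡n ⟨
      100 * (partSize part V₁ + k)                ≡⟨ *-distribˡ-+ 100 (partSize part V₁) k ⟩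
      100 * partSize part V₁ + 100 * k            ≤⟨ +-monoʳ-≤ (100 * partSize part V₁) 100k≤n ⟩
      100 * partSize part V₁ + n                  ∎)
      where open ≤-Reasoning
    99n≤100|V| (suc zero) rewrite |V₂|≡n = *-monoˡ-≤ n (n≤1+n 99)
    99n≤100|V| (suc (suc zero)) rewrite |V₃|≡n = *-monoˡ-≤ n (n≤1+n 99)

    -- For sparse F, at most |F| + 2n/100 < 99n/100 ≤ |V_P| vertices of a part P lie on F or miss one of
    -- two prescribed arcs.
    Sparse : List (Fin N) → Set
    Sparse F = 100 * length F + 2 * n < 99 * n

    record Choice (P : Fin 3) (F ins outs : List (Fin N)) : Set where
      field
        vertex : Fin N
        inPart : part vertex ≡ P
        fresh  : occ vertex F ≡ 0
        from   : All (λ y → adj y vertex ≡ true) ins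
        to     : All (λ z → adj vertex z ≡ true) outs

    excluded<|V| : ∀ P F (l : ℕ) → l ≤ 2 → Sparse F → n * l + 100 * length F < 100 * partSize part P
    excluded<|V| P F l l≤2 sparse = begin-strict
      n * l + 100 * length F   ≤⟨ +-monoˡ-≤ (100 * length F) (*-monoʳ-≤ n l≤2) ⟩
      n * 2 + 100 * length F   ≡⟨ +-comm (n * 2) (100 * length F) ⟩
      100 * length F + n * 2   ≡⟨ cong (100 * length F +_) (*-comm n 2) ⟩
      100 * length F + 2 * n   <⟨ sparse ⟩
      99 * n                   ≤⟨ 99n≤100|V| P ⟩
      100 * partSize part P    ∎
      where open ≤-Reasoning

    positive-from-excess : ∀ c {X V} → V ≤ 100 * c + X → X < V → 0 < c
    positive-from-excess zero V≤X X<V = ⊥-elim (<-irrefl refl (<-≤-trans X<V V≤X))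
    positive-from-excess (suc c) _ _ = s≤s z≤n

    choose : ∀ P F ins outs → All (λ y → next3 (part y) ≡ P) ins → All (λ z → prev3 (part z) ≡ P) outs →
      length ins + length outs ≤ 2 → Sparse F → Choice P F ins outs
    choose P F ins outs ins→P outs→P ≤2 sparse = fromCandidate (count-witness (Candidate P F ins outs)
      (positive-from-excess (count (Candidate P F ins outs)) (candidates-many P F ins outs ins→P outs→P)
        (excluded<|V| P F (length ins + length outs) ≤2 sparse)))
      where
      fromCandidate : Σ (Fin N) (λ v → Candidate P F ins outs v ≡ true) → Choice P F ins outs
      fromCandidate (v , cand) = record
        { vertex = v
        ; inPart = ∈ₚ⇒ (proj₁ split₃)
        ; fresh  = ¬positive⇒≡0 (occ v F) (proj₂ split₃)
        ; from   = all≡true⇒All (λ y → adj y v) ins (proj₂ split₂)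
        ; to     = all≡true⇒All (adj v) outs (proj₂ split₁)
        }
        where
        split₁ = ∧-true⇒ {((v ∈ₚ P) ∧ not (positive (occ v F))) ∧ all (λ y → adj y v) ins} cand
        split₂ = ∧-true⇒ {(v ∈ₚ P) ∧ not (positive (occ v F))} (proj₁ split₁)
        split₃ = ∧-true⇒ {v ∈ₚ P} (proj₁ split₂)

    matched : List (Fin N)
    matched = tabulate tail ++ tabulate head

    tail∈matched : ∀ e → 1 ≤ occ (tail e) matched
    tail∈matched e = ≤-trans (occ-tabulate tail e) (≤-trans (m≤m+n _ _) (≤-reflexive (sym (occ-++ (tail e) (tabulate tail) _))))

    head∈matched : ∀ e → 1 ≤ occ (head e) matched
    head∈matched e = ≤-trans (occ-tabulate head e) (≤-trans (m≤n+m _ _) (≤-reflexive (sym (occ-++ (head e) (tabulate tail) _))))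

    length-matched : length matched ≡ k + k
    length-matched = trans (length-++ (tabulate tail)) (cong₂ _+_ (length-tabulate tail) (length-tabulate head))

    -- The path a → b → c, or a → b → tail e → head e → c if the block carries the matching edge e.
    record Block : Set where
      constructor block
      field
        a b c : Fin N
        edge  : Maybe (Fin k)
    open Block

    after-b : Maybe (Fin k) → Fin N → List (Fin N)
    after-b nothing c = c ∷ []
    after-b (just e) c = tail e ∷ head e ∷ c ∷ []

    entry : Maybe (Fin k) → Fin N → Fin N
    entry nothing c = c
    entry (just e) c = tail e

    b⁺ : Block → Fin N
    b⁺ y = entry (edge y) (c y)

    verticesᵇ : Block → List (Fin N)
    verticesᵇ y = a y ∷ b y ∷ after-b (edge y) (c y)

    vertices : List Block → List (Fin N)
    vertices = concatMap verticesᵇ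

    IntoC : Maybe (Fin k) → Fin N → Set
    IntoC nothing c = ⊤
    IntoC (just e) c = adj (head e) c ≡ true

    record WellFormed (y : Block) : Set where
      field
        a∈V₁ : part (a y) ≡ V₁
        b∈V₂ : part (b y) ≡ V₂
        c∈V₃ : part (c y) ≡ V₃
        a→b  : adj (a y) (b y) ≡ true
        b→   : adj (b y) (b⁺ y) ≡ true
        →c   : IntoC (edge y) (c y)
    open WellFormed

    Chain : Fin N → List Block → Block → Set
    Chain u [] z = adj u (a z) ≡ true
    Chain u (y ∷ L) z = adj u (a y) ≡ true × Chain (c y) L z

    first-a : List Block → Block → Fin N
    first-a [] z = a z
    first-a (y ∷ L) z = a y

    chain-from : ∀ {u} u′ L z → Chain u L z → adj u′ (first-a L z) ≡ true → Chain u′ L z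
    chain-from u′ [] z _ u′→ = u′→
    chain-from u′ (y ∷ L) z (_ , ch) u′→ = u′→ , ch

    through-block : ∀ y {rest w} → WellFormed y → Walk (c y) rest w → Walk (a y) (b y ∷ after-b (edge y) (c y) ++ rest) w
    through-block (block _ _ _ nothing) wf wk = a→b wf , b→ wf , wk
    through-block (block _ _ _ (just e)) wf wk = a→b wf , b→ wf , isArc e , →c wf , wk

    chain⇒walk : ∀ {u} L z → All WellFormed L → Chain u L z → Walk u (vertices L) (a z)
    chain⇒walk [] z [] u→ = u→
    chain⇒walk (y ∷ L) z (wf ∷ wfs) (u→a , ch) = u→a , through-block y wf (chain⇒walk L z wfs ch)

    -- The blocks x₀, L₁, …, Lₘ in cyclic order, joined by the arcs c x₀ → a L₁, …, c Lₘ → a x₀.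
    record BlockCycle (x₀ : Block) (L : List Block) : Set where
      field
        wellFormed : All WellFormed (x₀ ∷ L)
        chain      : Chain (c x₀) L x₀
        distinct   : Distinct (vertices (x₀ ∷ L))

    part-≢ : ∀ {x y P Q} → part x ≡ P → part y ≡ Q → ¬ P ≡ Q → ¬ x ≡ y
    part-≢ refl refl P≢Q refl = P≢Q refl

    V₁≢V₂ : ¬ V₁ ≡ V₂
    V₁≢V₂ ()
    V₁≢V₃ : ¬ V₁ ≡ V₃
    V₁≢V₃ ()
    V₂≢V₃ : ¬ V₂ ≡ V₃
    V₂≢V₃ ()
    V₃≢V₂ : ¬ V₃ ≡ V₂
    V₃≢V₂ ()

    distinct-triple : ∀ {x y z} → part x ≡ V₁ → part y ≡ V₂ → part z ≡ V₃ → Distinct (x ∷ y ∷ z ∷ [])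
    distinct-triple x∈V₁ y∈V₂ z∈V₃ =
      distinct-cons (part-≢ x∈V₁ y∈V₂ V₁≢V₂ ∷ part-≢ x∈V₁ z∈V₃ V₁≢V₃ ∷ [])
        (distinct-cons (part-≢ y∈V₂ z∈V₃ V₂≢V₃ ∷ []) (distinct-cons [] (λ _ → z≤n)))

    distinct-block : ∀ y → WellFormed y → occ (b y) matched ≡ 0 → occ (c y) matched ≡ 0 → Distinct (verticesᵇ y)
    distinct-block (block a b c nothing) wf _ _ = distinct-triple (a∈V₁ wf) (b∈V₂ wf) (c∈V₃ wf)
    distinct-block (block a b c (just e)) wf b∉ c∉ =
      distinct-cons (a≢b ∷ a≢t ∷ a≢h ∷ a≢c ∷ [])
        (distinct-cons (b≢t ∷ b≢h ∷ b≢c ∷ [])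
          (distinct-cons (t≢h ∷ t≢c ∷ [])
            (distinct-cons (h≢c ∷ []) (distinct-cons [] (λ _ → z≤n)))))
      where
      t∈V₃ = proj₁ (M-parts e)
      h∈V₂ = proj₂ (M-parts e)
      a≢b = part-≢ (a∈V₁ wf) (b∈V₂ wf) V₁≢V₂
      a≢t = part-≢ (a∈V₁ wf) t∈V₃ V₁≢V₃
      a≢h = part-≢ (a∈V₁ wf) h∈V₂ V₁≢V₂
      a≢c = part-≢ (a∈V₁ wf) (c∈V₃ wf) V₁≢V₃
      b≢t = part-≢ (b∈V₂ wf) t∈V₃ V₂≢V₃
      b≢h = absent≢present matched b∉ (head∈matched e)
      b≢c = part-≢ (b∈V₂ wf) (c∈V₃ wf) V₂≢V₃
      t≢h = part-≢ t∈V₃ h∈V₂ V₃≢V₂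
      t≢c = λ t≡c → absent≢present matched c∉ (tail∈matched e) (sym t≡c)
      h≢c = part-≢ h∈V₂ (c∈V₃ wf) V₂≢V₃

    distinct-insert : ∀ x₀ y L → Distinct (vertices (x₀ ∷ L)) → Distinct (verticesᵇ y) →
      All (λ v → occ v (vertices (x₀ ∷ L)) ≡ 0) (verticesᵇ y) → Distinct (vertices (x₀ ∷ y ∷ L))
    distinct-insert x₀ y L d dy y∉ =
      distinct-merge {old = vertices (x₀ ∷ L)} {new = vertices (x₀ ∷ y ∷ L)} (verticesᵇ y) d dy
        (absent-from-members {old = vertices (x₀ ∷ L)} (verticesᵇ y) y∉)
      (λ v → occ-middle v (verticesᵇ x₀) (verticesᵇ y) (vertices L))

    EndsAbsent : Maybe (Fin k) → List (Fin N) → Set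
    EndsAbsent nothing F = ⊤
    EndsAbsent (just e) F = (occ (tail e) F ≡ 0) × (occ (head e) F ≡ 0)

    record Extension (x₀ : Block) (L : List Block) (m : Maybe (Fin k)) : Set where
      field
        new       : Block
        carries   : edge new ≡ m
        cycle     : BlockCycle x₀ (new ∷ L)
        abc-fresh : All (λ v → occ v (vertices (x₀ ∷ L) ++ matched) ≡ 0) (a new ∷ b new ∷ c new ∷ [])

    first-a∈V₁ : ∀ x₀ L → All WellFormed (x₀ ∷ L) → part (first-a L x₀) ≡ V₁
    first-a∈V₁ x₀ [] (wf ∷ _) = a∈V₁ wf
    first-a∈V₁ x₀ (y ∷ L) (_ ∷ wf ∷ _) = a∈V₁ wf

    block-absent : ∀ y Fl → EndsAbsent (edge y) Fl →
      All (λ v → occ v (Fl ++ matched) ≡ 0) (a y ∷ b y ∷ c y ∷ []) → All (λ v → occ v Fl ≡ 0) (verticesᵇ y)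
    block-absent (block a b c nothing) Fl _ (a∉ ∷ b∉ ∷ c∉ ∷ []) =
      occ-++≡0ˡ a Fl matched a∉ ∷ occ-++≡0ˡ b Fl matched b∉ ∷ occ-++≡0ˡ c Fl matched c∉ ∷ []
    block-absent (block a b c (just e)) Fl (t∉ , h∉) (a∉ ∷ b∉ ∷ c∉ ∷ []) =
      occ-++≡0ˡ a Fl matched a∉ ∷ occ-++≡0ˡ b Fl matched b∉ ∷ t∉ ∷ h∉ ∷ occ-++≡0ˡ c Fl matched c∉ ∷ []

    extension : ∀ {x₀ L m} → BlockCycle x₀ L → EndsAbsent m (vertices (x₀ ∷ L)) → (y : Block) → edge y ≡ m →
      WellFormed y → adj (c x₀) (a y) ≡ true → adj (c y) (first-a L x₀) ≡ true →
      All (λ v → occ v (vertices (x₀ ∷ L) ++ matched) ≡ 0) (a y ∷ b y ∷ c y ∷ []) → Extension x₀ L m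
    extension {x₀} {L} cyc ends y carries wf c₀→a c→ abc∉ = record
      { new = y
      ; carries = carries
      ; cycle = record
        { wellFormed = All.head wellFormed ∷ wf ∷ All.tail wellFormed
        ; chain = c₀→a , chain-from (c y) L x₀ chain c→
        ; distinct = distinct-insert x₀ y L distinct
            (distinct-block y wf (unmatched (All.lookup abc∉ b∈)) (unmatched (All.lookup abc∉ c∈)))
            (block-absent y Fl (subst (λ m → EndsAbsent m Fl) (sym carries) ends) abc∉)
        }
      ; abc-fresh = abc∉
      }
      where
      open BlockCycle cyc
      Fl = vertices (x₀ ∷ L)
      unmatched : ∀ {v} → occ v (Fl ++ matched) ≡ 0 → occ v matched ≡ 0
      unmatched {v} = occ-++≡0ʳ v Fl matched
      b∈ = there (here refl)
      c∈ = there (there (here refl))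

    module _ {x₀ L} (cyc : BlockCycle x₀ L) (sparse : Sparse (vertices (x₀ ∷ L) ++ matched)) where
      private
        F = vertices (x₀ ∷ L) ++ matched
        wf₀ = All.head (BlockCycle.wellFormed cyc)
        next-a∈V₁ = first-a∈V₁ x₀ L (BlockCycle.wellFormed cyc)
        α = choose V₁ F (c x₀ ∷ []) [] (cong next3 (c∈V₃ wf₀) ∷ []) [] (s≤s z≤n) sparse
        a′ = Choice.vertex α

      extend : (m : Maybe (Fin k)) → EndsAbsent m (vertices (x₀ ∷ L)) → Extension x₀ L m
      extend nothing ends = extension cyc ends (block a′ b′ c′ nothing) refl wf
        (All.head (Choice.from α)) (All.head (Choice.to γ)) (Choice.fresh α ∷ Choice.fresh β ∷ Choice.fresh γ ∷ [])
        where
        β = choose V₂ F (a′ ∷ []) [] (cong next3 (Choice.inPart α) ∷ []) [] (s≤s z≤n) sparse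
        b′ = Choice.vertex β
        γ = choose V₃ F (b′ ∷ []) (first-a L x₀ ∷ [])
              (cong next3 (Choice.inPart β) ∷ []) (cong prev3 next-a∈V₁ ∷ []) ≤-refl sparse
        c′ = Choice.vertex γ
        wf : WellFormed (block a′ b′ c′ nothing)
        wf = record { a∈V₁ = Choice.inPart α ; b∈V₂ = Choice.inPart β ; c∈V₃ = Choice.inPart γ
                    ; a→b = All.head (Choice.from β) ; b→ = All.head (Choice.from γ) ; →c = tt }
      extend (just e) ends = extension cyc ends (block a′ b′ c′ (just e)) refl wf
        (All.head (Choice.from α)) (All.head (Choice.to γ)) (Choice.fresh α ∷ Choice.fresh β ∷ Choice.fresh γ ∷ [])
        where
        β = choose V₂ F (a′ ∷ []) (tail e ∷ [])
              (cong next3 (Choice.inPart α) ∷ []) (cong prev3 (proj₁ (M-parts e)) ∷ []) ≤-refl sparse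
        b′ = Choice.vertex β
        γ = choose V₃ F (head e ∷ []) (first-a L x₀ ∷ [])
              (cong next3 (proj₂ (M-parts e)) ∷ []) (cong prev3 next-a∈V₁ ∷ []) ≤-refl sparse
        c′ = Choice.vertex γ
        wf : WellFormed (block a′ b′ c′ (just e))
        wf = record { a∈V₁ = Choice.inPart α ; b∈V₂ = Choice.inPart β ; c∈V₃ = Choice.inPart γ
                    ; a→b = All.head (Choice.from β) ; b→ = All.head (Choice.to β) ; →c = All.head (Choice.from γ) }

    #carrying : List Block → ℕ
    #carrying = countL (λ y → is-just (edge y))

    length-vertices : ∀ Ls → length (vertices Ls) ≡ 3 * length Ls + 2 * #carrying Ls
    length-vertices [] = refl
    length-vertices (y ∷ Ls) = begin
      length (verticesᵇ y ++ vertices Ls)                       ≡⟨ length-++ (verticesᵇ y) ⟩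
      length (verticesᵇ y) + length (vertices Ls)               ≡⟨ cong₂ _+_ (length-block y) (length-vertices Ls) ⟩
      (3 + 2 * 𝟙 (is-just (edge y))) + (3 * length Ls + 2 * #carrying Ls)
        ≡⟨ rearrange (𝟙 (is-just (edge y))) (length Ls) (#carrying Ls) ⟩
      3 * length (y ∷ Ls) + 2 * #carrying (y ∷ Ls)              ∎
      where
      open ≡-Reasoning
      length-block : ∀ y → length (verticesᵇ y) ≡ 3 + 2 * 𝟙 (is-just (edge y))
      length-block (block _ _ _ nothing) = refl
      length-block (block _ _ _ (just _)) = refl
      rearrange : ∀ j l J → (3 + 2 * j) + (3 * l + 2 * J) ≡ 3 * suc l + 2 * (j + J)
      rearrange = solve-∀

    occ-map≤occ-vertices : (g : Block → Fin N) → (∀ y → 1 ≤ occ (g y) (verticesᵇ y)) →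
      ∀ v Ls → occ v (map g Ls) ≤ occ v (vertices Ls)
    occ-map≤occ-vertices g g∈ v [] = z≤n
    occ-map≤occ-vertices g g∈ v (y ∷ Ls) =
      ≤-trans (+-mono-≤ (hit (v == g y) refl) (occ-map≤occ-vertices g g∈ v Ls))
              (≤-reflexive (sym (occ-++ v (verticesᵇ y) (vertices Ls))))
      where
      hit : ∀ b → (v == g y) ≡ b → 𝟙 b ≤ occ v (verticesᵇ y)
      hit true eq rewrite ==⇒≡ v (g y) eq = g∈ y
      hit false _ = z≤n

    b⁺∈block : ∀ y → 1 ≤ occ (b⁺ y) (verticesᵇ y)
    b⁺∈block (block a b c nothing) = occ-at c (a ∷ b ∷ []) []
    b⁺∈block (block a b c (just e)) = occ-at (tail e) (a ∷ b ∷ []) (head e ∷ c ∷ [])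

    -- In a carrying block, b⁺ is the tail of its edge.
    #carrying≤k : ∀ Ls → Distinct (vertices Ls) → #carrying Ls ≤ k
    #carrying≤k Ls d = begin
      #carrying Ls                          ≤⟨ countL≤count b⁺ (λ y → is-just (edge y)) is-tail Ls distinct-b⁺ (tails-of Ls) ⟩
      count is-tail                         ≤⟨ count-occurring≤countL (λ _ → true) (tabulate tail) ⟩
      countL (λ _ → true) (tabulate tail)   ≤⟨ countL≤length _ (tabulate tail) ⟩
      length (tabulate tail)                ≡⟨ length-tabulate tail ⟩
      k                                     ∎
      where
      open ≤-Reasoning
      is-tail : Fin N → Bool
      is-tail v = true ∧ positive (occ v (tabulate tail))
      distinct-b⁺ : Distinct (map b⁺ Ls)
      distinct-b⁺ v = ≤-trans (occ-map≤occ-vertices b⁺ b⁺∈block v Ls) (d v)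
      tails-of : ∀ Ls → All (λ y → is-just (edge y) ≡ true → is-tail (b⁺ y) ≡ true) Ls
      tails-of [] = []
      tails-of (block _ _ _ nothing ∷ Ls) = (λ ()) ∷ tails-of Ls
      tails-of (block _ _ _ (just e) ∷ Ls) = (λ _ → 1≤⇒positive (occ-tabulate tail e)) ∷ tails-of Ls
        where
        1≤⇒positive : ∀ {m} → 1 ≤ m → positive m ≡ true
        1≤⇒positive {suc m} _ = refl

    sparse-if-short : ∀ Ls → Distinct (vertices Ls) → 100 * length Ls ≤ 7 * n + 100 → Sparse (vertices Ls ++ matched)
    sparse-if-short Ls d short = begin-strict
      100 * length (vertices Ls ++ matched) + 2 * n
        ≡⟨ cong (λ ℓ → 100 * ℓ + 2 * n) (trans (length-++ (vertices Ls)) (cong₂ _+_ (length-vertices Ls) length-matched)) ⟩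
      100 * ((3 * l + 2 * j) + (k + k)) + 2 * n
        ≡⟨ expand l j k n ⟩
      3 * (100 * l) + 2 * (100 * j) + 2 * (100 * k) + 2 * n
        ≤⟨ +-monoˡ-≤ (2 * n) (+-mono-≤ (+-mono-≤ (*-monoʳ-≤ 3 short) (*-monoʳ-≤ 2 100j≤n)) (*-monoʳ-≤ 2 100k≤n)) ⟩
      3 * (7 * n + 100) + 2 * n + 2 * n + 2 * n
        ≡⟨ collect n ⟩
      27 * n + 300
        <⟨ +-monoʳ-< (27 * n) (<-≤-trans (m≤m+n 301 6899) (*-monoʳ-≤ 72 100≤n)) ⟩
      27 * n + 72 * n
        ≡⟨ rearrange n ⟩
      99 * n ∎
      where
      open ≤-Reasoning
      l = length Ls
      j = #carrying Ls
      100j≤n : 100 * j ≤ n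
      100j≤n = ≤-trans (*-monoʳ-≤ 100 (#carrying≤k Ls d)) 100k≤n
      expand : ∀ l j k n → 100 * ((3 * l + 2 * j) + (k + k)) + 2 * n ≡ 3 * (100 * l) + 2 * (100 * j) + 2 * (100 * k) + 2 * n
      expand = solve-∀
      collect : ∀ n → 3 * (7 * n + 100) + 2 * n + 2 * n + 2 * n ≡ 27 * n + 300
      collect = solve-∀
      rearrange : ∀ n → 27 * n + 72 * n ≡ 99 * n
      rearrange = solve-∀

    seed : Σ Block λ x₀ → BlockCycle x₀ [] × All (λ v → occ v matched ≡ 0) (verticesᵇ x₀)
    seed = x₀ , record { wellFormed = wf ∷ [] ; chain = All.head (Choice.to γ) ; distinct = distinct₀ }
              , Choice.fresh α ∷ Choice.fresh β ∷ Choice.fresh γ ∷ []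
      where
      sparse : Sparse matched
      sparse = sparse-if-short [] (λ _ → z≤n) z≤n
      α = choose V₁ matched [] [] [] [] z≤n sparse
      β = choose V₂ matched (Choice.vertex α ∷ []) [] (cong next3 (Choice.inPart α) ∷ []) [] (s≤s z≤n) sparse
      γ = choose V₃ matched (Choice.vertex β ∷ []) (Choice.vertex α ∷ [])
            (cong next3 (Choice.inPart β) ∷ []) (cong prev3 (Choice.inPart α) ∷ []) ≤-refl sparse
      x₀ = block (Choice.vertex α) (Choice.vertex β) (Choice.vertex γ) nothing
      wf : WellFormed x₀
      wf = record { a∈V₁ = Choice.inPart α ; b∈V₂ = Choice.inPart β ; c∈V₃ = Choice.inPart γ
                  ; a→b = All.head (Choice.from β) ; b→ = All.head (Choice.from γ) ; →c = tt }
      distinct₀ : Distinct (vertices (x₀ ∷ []))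
      distinct₀ = subst Distinct (sym (++-identityʳ (verticesᵇ x₀)))
                    (distinct-block x₀ wf (Choice.fresh β) (Choice.fresh γ))

    -- Stage 1: a block for every matching edge

    Carries : Fin k → List Block → Set
    Carries e = Any (λ y → edge y ≡ just e)

    MatchedOnlyBefore : ℕ → List Block → Set
    MatchedOnlyBefore j Ls = ∀ x → 1 ≤ occ x (vertices Ls) →
      occ x matched ≡ 0 ⊎ Σ (Fin k) λ e → toℕ e < j × (x ≡ tail e ⊎ x ≡ head e)

    record Stage₁ (j : ℕ) (x₀ : Block) (L : List Block) : Set where
      field
        cycle   : BlockCycle x₀ L
        size    : length L ≡ j
        matched-before : MatchedOnlyBefore j (x₀ ∷ L)
        carried : ∀ e → toℕ e < j → Carries e (x₀ ∷ L)

    endpoints-unused : ∀ {j} Ls (e : Fin k) → toℕ e ≡ j → MatchedOnlyBefore j Ls → EndsAbsent (just e) (vertices Ls)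
    endpoints-unused {j} Ls e e≡j before = unused (tail e) tail∉ , unused (head e) head∉
      where
      unused : ∀ x → (1 ≤ occ x (vertices Ls) → ⊥) → occ x (vertices Ls) ≡ 0
      unused x ¬used = n≤0⇒n≡0 (≤-pred (≰⇒> ¬used))
      other : ∀ {e′} → toℕ e′ < j → ¬ e ≡ e′
      other e′<j refl = <-irrefl e≡j e′<j
      tail∉ : 1 ≤ occ (tail e) (vertices Ls) → ⊥
      tail∉ p with before (tail e) p
      ... | inj₁ t∉ = absent≢present matched t∉ (tail∈matched e) refl
      ... | inj₂ (e′ , e′<j , inj₁ t≡t) = proj₁ (disjoint e e′ (other e′<j)) t≡t
      ... | inj₂ (e′ , e′<j , inj₂ t≡h) = proj₁ (proj₂ (disjoint e e′ (other e′<j))) t≡h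
      head∉ : 1 ≤ occ (head e) (vertices Ls) → ⊥
      head∉ p with before (head e) p
      ... | inj₁ h∉ = absent≢present matched h∉ (head∈matched e) refl
      ... | inj₂ (e′ , e′<j , inj₁ h≡t) = proj₁ (proj₂ (proj₂ (disjoint e e′ (other e′<j)))) h≡t
      ... | inj₂ (e′ , e′<j , inj₂ h≡h) = proj₂ (proj₂ (proj₂ (disjoint e e′ (other e′<j)))) h≡h

    carries-after-x₀ : ∀ {e x₀} y L → Carries e (x₀ ∷ L) → Carries e (x₀ ∷ y ∷ L)
    carries-after-x₀ y L (here p) = here p
    carries-after-x₀ y L (there p) = there (there p)

    stage₁-grow : ∀ {j x₀ L} → Stage₁ j x₀ L → (e : Fin k) → toℕ e ≡ j → Extension x₀ L (just e) →
      Σ (List Block) (Stage₁ (suc j) x₀)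
    stage₁-grow {j} {x₀} {L} st e e≡j
      record { new = block a′ b′ c′ .(just e) ; carries = refl ; cycle = cycle′ ; abc-fresh = a∉ ∷ b∉ ∷ c∉ ∷ [] } =
      y ∷ L , record { cycle = cycle′ ; size = cong suc size ; matched-before = before′ ; carried = carried′ }
      where
      open Stage₁ st
      y = block a′ b′ c′ (just e)
      Fl = vertices (x₀ ∷ L)
      e<1+j : toℕ e < suc j
      e<1+j = s≤s (≤-reflexive e≡j)
      in-block : ∀ {x} → x ∈ verticesᵇ y →
        occ x matched ≡ 0 ⊎ Σ (Fin k) λ e′ → toℕ e′ < suc j × (x ≡ tail e′ ⊎ x ≡ head e′)
      in-block (here refl) = inj₁ (occ-++≡0ʳ a′ Fl matched a∉)
      in-block (there (here refl)) = inj₁ (occ-++≡0ʳ b′ Fl matched b∉)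
      in-block (there (there (here refl))) = inj₂ (e , e<1+j , inj₁ refl)
      in-block (there (there (there (here refl)))) = inj₂ (e , e<1+j , inj₂ refl)
      in-block (there (there (there (there (here refl))))) = inj₁ (occ-++≡0ʳ c′ Fl matched c∉)
      before′ : MatchedOnlyBefore (suc j) (x₀ ∷ y ∷ L)
      before′ x p with 1≤+⇒ (occ x (verticesᵇ y)) (subst (1 ≤_) (occ-middle x (verticesᵇ x₀) (verticesᵇ y) (vertices L)) p)
      ... | inj₁ in-y = in-block (occ⇒∈ (verticesᵇ y) in-y)
      ... | inj₂ in-old with matched-before x in-old
      ...   | inj₁ x∉ = inj₁ x∉
      ...   | inj₂ (e′ , e′<j , x∈e′) = inj₂ (e′ , m<n⇒m<1+n e′<j , x∈e′)
      carried′ : ∀ e′ → toℕ e′ < suc j → Carries e′ (x₀ ∷ y ∷ L)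
      carried′ e′ e′<1+j with toℕ e′ ≟ℕ j
      ... | yes e′≡j = there (here (cong just (toℕ-injective (trans e≡j (sym e′≡j)))))
      ... | no e′≢j = carries-after-x₀ y L (carried e′ (≤∧≢⇒< (≤-pred e′<1+j) e′≢j))

    stage₁-step : ∀ {j x₀ L} → j < k → Stage₁ j x₀ L → Σ (List Block) (Stage₁ (suc j) x₀)
    stage₁-step {j} {x₀} {L} j<k st =
      stage₁-grow st e e≡j (extend cycle sparse (just e) (endpoints-unused (x₀ ∷ L) e e≡j matched-before))
      where
      open Stage₁ st
      e = fromℕ< j<k
      e≡j : toℕ e ≡ j
      e≡j = toℕ-fromℕ< j<k
      short : 100 * suc (length L) ≤ 7 * n + 100
      short = ≤-trans (*-monoʳ-≤ 100 (subst (_< k) (sym size) j<k)) (≤-trans 100k≤n (≤-trans (m≤n*m n 7) (m≤m+n (7 * n) 100)))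
      sparse = sparse-if-short (x₀ ∷ L) (BlockCycle.distinct cycle) short

    start₁ : (Σ Block λ x₀ → BlockCycle x₀ [] × All (λ v → occ v matched ≡ 0) (verticesᵇ x₀)) →
      Σ Block λ x₀ → Σ (List Block) (Stage₁ 0 x₀)
    start₁ (x₀ , cycle₀ , unmatched) = x₀ , [] , record
      { cycle = cycle₀
      ; size = refl
      ; matched-before = λ x p → inj₁ (absent-from-members {old = matched} (verticesᵇ x₀) unmatched x
                                         (subst (λ xs → 1 ≤ occ x xs) (++-identityʳ (verticesᵇ x₀)) p))
      ; carried = λ e ()
      }

    stage₁ : ∀ j → j ≤ k → Σ Block λ x₀ → Σ (List Block) (Stage₁ j x₀)
    stage₁ zero _ = start₁ seed
    stage₁ (suc j) j<k = continue (stage₁ j (<⇒≤ j<k))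
      where
      continue : (Σ Block λ x₀ → Σ (List Block) (Stage₁ j x₀)) → Σ Block λ x₀ → Σ (List Block) (Stage₁ (suc j) x₀)
      continue (x₀ , L , st) = x₀ , stage₁-step j<k st

    -- Stage 2: absorbing unused vertices

    record Stage₂ (x₀ : Block) (L : List Block) : Set where
      field
        cycle       : BlockCycle x₀ L
        all-carried : ∀ e → Carries e (x₀ ∷ L)

    -- A block together with the vertex c of the block before it.
    Window : Set
    Window = Fin N × Block

    windows : Fin N → List Block → List Window
    windows u [] = []
    windows u (y ∷ L) = (u , y) ∷ windows (c y) L

    last-c : Fin N → List Block → Fin N
    last-c u [] = u
    last-c u (y ∷ L) = last-c (c y) L

    find-window : (p : Window → Bool) → ∀ u L → 0 < countL p (windows u L) →
      Σ (List Block) λ pre → Σ Block λ y → Σ (List Block) λ post → (L ≡ pre ++ y ∷ post) × (p (last-c u pre , y) ≡ true)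
    find-window p u (y ∷ L) pos with p (u , y) in eq
    ... | true = [] , y , L , refl , eq
    ... | false with find-window p (c y) L pos
    ...   | pre , y′ , post , L≡ , p-y′ = y ∷ pre , y′ , post , cong (y ∷_) L≡ , p-y′

    length-windows : ∀ u L → length (windows u L) ≡ length L
    length-windows u [] = refl
    length-windows u (y ∷ L) = cong suc (length-windows (c y) L)

    -- The window (u , y) absorbs a′, b′, c′ if u → a′ → b y → c′ → a y → b′ → b⁺ y is a path: then y can be
    -- replaced by the blocks a′ → b y → c′ and a y → b′ → ⋯ → c y.
    Absorbs : Fin N → Fin N → Fin N → Window → Bool
    Absorbs a′ b′ c′ (u , y) =
      adj u a′ ∧ (adj a′ (b y) ∧ (adj (b y) c′ ∧ (adj c′ (a y) ∧ (adj (a y) b′ ∧ adj b′ (b⁺ y)))))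

    few-failures : (role : Window → Fin N) (P : Fin 3) (g : Fin N → Bool) (W : List Window) →
      Distinct (map role W) → All (λ w → part (role w) ≡ P) W → 100 * count (λ v → (v ∈ₚ P) ∧ not (g v)) ≤ n →
      100 * countL (λ w → not (g (role w))) W ≤ n
    few-failures role P g W d parts bound =
      ≤-trans (*-monoʳ-≤ 100 (countL≤count role (λ w → not (g (role w))) (λ v → (v ∈ₚ P) ∧ not (g v)) W d (implied W parts)))
              bound
      where
      implied : ∀ W → All (λ w → part (role w) ≡ P) W →
        All (λ w → not (g (role w)) ≡ true → (role w ∈ₚ P) ∧ not (g (role w)) ≡ true) W
      implied [] [] = []
      implied (w ∷ W) (p ∷ ps) = (λ ¬g → subst (λ t → t ∧ not (g (role w)) ≡ true) (sym (⇒∈ₚ p)) ¬g) ∷ implied W ps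

    few-non-out-of : ∀ x {P} → next3 (part x) ≡ P → 100 * count (λ v → (v ∈ₚ P) ∧ not (adj x v)) ≤ n
    few-non-out-of x refl = few-non-out x

    few-non-into : ∀ x {P} → prev3 (part x) ≡ P → 100 * count (λ v → (v ∈ₚ P) ∧ not (adj v x)) ≤ n
    few-non-into x refl = few-non-in x

    c∈block : ∀ y → 1 ≤ occ (c y) (verticesᵇ y)
    c∈block (block a b c nothing) = occ-at c (a ∷ b ∷ []) []
    c∈block (block a b c (just e)) = occ-at c (a ∷ b ∷ tail e ∷ head e ∷ []) []

    windows-first : ∀ v u L → occ v (map proj₁ (windows u L)) ≤ occ v (u ∷ map c L)
    windows-first v u [] = z≤n
    windows-first v u (y ∷ L) = +-monoʳ-≤ (𝟙 (v == u)) (windows-first v (c y) L)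

    windows-second : ∀ (g : Block → Fin N) u L → map (λ w → g (proj₂ w)) (windows u L) ≡ map g L
    windows-second g u [] = refl
    windows-second g u (y ∷ L) = cong (g y ∷_) (windows-second g (c y) L)

    distinct-entries : ∀ x₀ L → Distinct (vertices (x₀ ∷ L)) → Distinct (map proj₁ (windows (c x₀) L))
    distinct-entries x₀ L d v = ≤-trans (windows-first v (c x₀) L) (≤-trans (occ-map≤occ-vertices c c∈block v (x₀ ∷ L)) (d v))

    distinct-roles : ∀ (g : Block → Fin N) → (∀ y → 1 ≤ occ (g y) (verticesᵇ y)) → ∀ x₀ L →
      Distinct (vertices (x₀ ∷ L)) → Distinct (map (λ w → g (proj₂ w)) (windows (c x₀) L))
    distinct-roles g g∈ x₀ L d v rewrite windows-second g (c x₀) L =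
      ≤-trans (occ-map≤occ-vertices g g∈ v L)
        (≤-trans (m≤n+m _ _) (≤-trans (≤-reflexive (sym (occ-++ v (verticesᵇ x₀) (vertices L)))) (d v)))

    entries∈V₃ : ∀ u L → part u ≡ V₃ → All WellFormed L → All (λ w → part (proj₁ w) ≡ V₃) (windows u L)
    entries∈V₃ u [] _ [] = []
    entries∈V₃ u (y ∷ L) u∈V₃ (wf ∷ wfs) = u∈V₃ ∷ entries∈V₃ (c y) L (c∈V₃ wf) wfs

    roles∈ : ∀ (g : Block → Fin N) P → (∀ y → WellFormed y → part (g y) ≡ P) → ∀ u L → All WellFormed L →
      All (λ w → part (g (proj₂ w)) ≡ P) (windows u L)
    roles∈ g P g∈P u [] [] = []
    roles∈ g P g∈P u (y ∷ L) (wf ∷ wfs) = g∈P y wf ∷ roles∈ g P g∈P (c y) L wfs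

    b⁺∈V₃ : ∀ y → WellFormed y → part (b⁺ y) ≡ V₃
    b⁺∈V₃ (block a b c nothing) wf = c∈V₃ wf
    b⁺∈V₃ (block a b c (just e)) _ = proj₁ (M-parts e)

    a∈block : ∀ y → 1 ≤ occ (a y) (verticesᵇ y)
    a∈block y = occ-at (a y) [] (b y ∷ after-b (edge y) (c y))

    b∈block : ∀ y → 1 ≤ occ (b y) (verticesᵇ y)
    b∈block y = occ-at (b y) (a y ∷ []) (after-b (edge y) (c y))

    100*-+-mono : ∀ x y {X Y} → 100 * x ≤ X → 100 * y ≤ Y → 100 * (x + y) ≤ X + Y
    100*-+-mono x y x≤ y≤ = ≤-trans (≤-reflexive (*-distribˡ-+ 100 x y)) (+-mono-≤ x≤ y≤)

    module _ {x₀ L} (cyc : BlockCycle x₀ L) {a′ b′ c′}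
             (a′∈V₁ : part a′ ≡ V₁) (b′∈V₂ : part b′ ≡ V₂) (c′∈V₃ : part c′ ≡ V₃) where
      private
        W = windows (c x₀) L
        wf₀ = All.head (BlockCycle.wellFormed cyc)
        wfs = All.tail (BlockCycle.wellFormed cyc)
        d = BlockCycle.distinct cyc

        fails : (Window → Bool) → ℕ
        fails t = countL (λ w → not (t w)) W

        t₁ t₂ t₃ t₄ t₅ t₆ : Window → Bool
        t₁ w = adj (proj₁ w) a′
        t₂ w = adj a′ (b (proj₂ w))
        t₃ w = adj (b (proj₂ w)) c′
        t₄ w = adj c′ (a (proj₂ w))
        t₅ w = adj (a (proj₂ w)) b′
        t₆ w = adj b′ (b⁺ (proj₂ w))

        blocked≤ : fails (Absorbs a′ b′ c′) ≤ fails t₁ + (fails t₂ + (fails t₃ + (fails t₄ + (fails t₅ + fails t₆))))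
        blocked≤ =
          ≤-trans (countL-not-∧ t₁ _ W) (+-monoʳ-≤ (fails t₁)
          (≤-trans (countL-not-∧ t₂ _ W) (+-monoʳ-≤ (fails t₂)
          (≤-trans (countL-not-∧ t₃ _ W) (+-monoʳ-≤ (fails t₃)
          (≤-trans (countL-not-∧ t₄ _ W) (+-monoʳ-≤ (fails t₄)
          (countL-not-∧ t₅ t₆ W))))))))

        as : Distinct (map (λ w → a (proj₂ w)) W)
        bs : Distinct (map (λ w → b (proj₂ w)) W)
        b⁺s : Distinct (map (λ w → b⁺ (proj₂ w)) W)
        as = distinct-roles a a∈block x₀ L d
        bs = distinct-roles b b∈block x₀ L d
        b⁺s = distinct-roles b⁺ b⁺∈block x₀ L d

        f₁ : 100 * fails t₁ ≤ n
        f₁ = few-failures proj₁ V₃ (λ v → adj v a′) W (distinct-entries x₀ L d) (entries∈V₃ (c x₀) L (c∈V₃ wf₀) wfs)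
               (few-non-into a′ (cong prev3 a′∈V₁))
        f₂ : 100 * fails t₂ ≤ n
        f₂ = few-failures (λ w → b (proj₂ w)) V₂ (adj a′) W bs (roles∈ b V₂ (λ _ → b∈V₂) (c x₀) L wfs)
               (few-non-out-of a′ (cong next3 a′∈V₁))
        f₃ : 100 * fails t₃ ≤ n
        f₃ = few-failures (λ w → b (proj₂ w)) V₂ (λ v → adj v c′) W bs (roles∈ b V₂ (λ _ → b∈V₂) (c x₀) L wfs)
               (few-non-into c′ (cong prev3 c′∈V₃))
        f₄ : 100 * fails t₄ ≤ n
        f₄ = few-failures (λ w → a (proj₂ w)) V₁ (adj c′) W as (roles∈ a V₁ (λ _ → a∈V₁) (c x₀) L wfs)
               (few-non-out-of c′ (cong next3 c′∈V₃))
        f₅ : 100 * fails t₅ ≤ n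
        f₅ = few-failures (λ w → a (proj₂ w)) V₁ (λ v → adj v b′) W as (roles∈ a V₁ (λ _ → a∈V₁) (c x₀) L wfs)
               (few-non-into b′ (cong prev3 b′∈V₂))
        f₆ : 100 * fails t₆ ≤ n
        f₆ = few-failures (λ w → b⁺ (proj₂ w)) V₃ (adj b′) W b⁺s (roles∈ b⁺ V₃ b⁺∈V₃ (c x₀) L wfs)
               (few-non-out-of b′ (cong next3 b′∈V₂))

      100·blocked≤6n : 100 * countL (λ w → not (Absorbs a′ b′ c′ w)) (windows (c x₀) L) ≤ 6 * n
      100·blocked≤6n = ≤-trans (*-monoʳ-≤ 100 blocked≤)
        (≤-trans (100*-+-mono (fails t₁) _ f₁ (100*-+-mono (fails t₂) _ f₂ (100*-+-mono (fails t₃) _ f₃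
                 (100*-+-mono (fails t₄) _ f₄ (100*-+-mono (fails t₅) (fails t₆) f₅ f₆)))))
                 (≤-reflexive (six n)))
        where
        six : ∀ n → n + (n + (n + (n + (n + n)))) ≡ 6 * n
        six = solve-∀

      absorbing-window : 7 * n < 100 * length L →
        Σ (List Block) λ pre → Σ Block λ y → Σ (List Block) λ post →
          (L ≡ pre ++ y ∷ post) × (Absorbs a′ b′ c′ (last-c (c x₀) pre , y) ≡ true)
      absorbing-window long = find-window (Absorbs a′ b′ c′) (c x₀) L
        (positive-from-excess (countL (Absorbs a′ b′ c′) W) 100·length≤ (begin-strict
          100 * fails (Absorbs a′ b′ c′)  ≤⟨ 100·blocked≤6n ⟩
          6 * n                           ≤⟨ *-monoˡ-≤ n (n≤1+n 6) ⟩
          7 * n                           <⟨ long ⟩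
          100 * length L                  ≡⟨ cong (100 *_) (length-windows (c x₀) L) ⟨
          100 * length W                  ∎))
        where
        open ≤-Reasoning
        100·length≤ : 100 * length W ≤ 100 * countL (Absorbs a′ b′ c′) W + 100 * fails (Absorbs a′ b′ c′)
        100·length≤ = ≤-reflexive (trans (cong (100 *_) (length≡countL+countL-not (Absorbs a′ b′ c′) W))
                                         (*-distribˡ-+ 100 (countL (Absorbs a′ b′ c′) W) (fails (Absorbs a′ b′ c′))))

    record Absorption (a′ b′ c′ u : Fin N) (y : Block) : Set where
      field
        u→a′ : adj u a′ ≡ true
        a′→b : adj a′ (b y) ≡ true
        b→c′ : adj (b y) c′ ≡ true
        c′→a : adj c′ (a y) ≡ true
        a→b′ : adj (a y) b′ ≡ true
        b′→  : adj b′ (b⁺ y) ≡ true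

    absorbs⇒ : ∀ {a′ b′ c′ u y} → Absorbs a′ b′ c′ (u , y) ≡ true → Absorption a′ b′ c′ u y
    absorbs⇒ {a′} {b′} {c′} {u} {y} t = record
      { u→a′ = proj₁ s₁ ; a′→b = proj₁ s₂ ; b→c′ = proj₁ s₃
      ; c′→a = proj₁ s₄ ; a→b′ = proj₁ s₅ ; b′→ = proj₂ s₅ }
      where
      s₁ = ∧-true⇒ {adj u a′} t
      s₂ = ∧-true⇒ {adj a′ (b y)} (proj₂ s₁)
      s₃ = ∧-true⇒ {adj (b y) c′} (proj₂ s₂)
      s₄ = ∧-true⇒ {adj c′ (a y)} (proj₂ s₃)
      s₅ = ∧-true⇒ {adj (a y) b′} (proj₂ s₄)

    chain-insert : ∀ u pre y y₁ y₂ post z → c y₂ ≡ c y → Chain u (pre ++ y ∷ post) z →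
      adj (last-c u pre) (a y₁) ≡ true → adj (c y₁) (a y₂) ≡ true → Chain u (pre ++ y₁ ∷ y₂ ∷ post) z
    chain-insert u [] y y₁ y₂ post z same (_ , ch) u→ →a = u→ , →a , subst (λ w → Chain w post z) (sym same) ch
    chain-insert u (x ∷ pre) y y₁ y₂ post z same (u→ , ch) →a₁ →a₂ =
      u→ , chain-insert (c x) pre y y₁ y₂ post z same ch →a₁ →a₂

    carries-split : ∀ {e} pre y y₁ y₂ post → edge y₂ ≡ edge y →
      Carries e (pre ++ y ∷ post) → Carries e (pre ++ y₁ ∷ y₂ ∷ post)
    carries-split [] y y₁ y₂ post same (here p) = there (here (trans same p))
    carries-split [] y y₁ y₂ post same (there p) = there (there p)
    carries-split (x ∷ pre) y y₁ y₂ post same (here p) = here p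
    carries-split (x ∷ pre) y y₁ y₂ post same (there p) = there (carries-split pre y y₁ y₂ post same p)

    occ-absorbed : ∀ v x₀ pre y post a′ b′ c′ →
      occ v (vertices (x₀ ∷ pre ++ block a′ (b y) c′ nothing ∷ block (a y) b′ (c y) (edge y) ∷ post))
        ≡ occ v (a′ ∷ b′ ∷ c′ ∷ []) + occ v (vertices (x₀ ∷ pre ++ y ∷ post))
    occ-absorbed v x₀ pre y post a′ b′ c′ =
      occ-++-shift v (verticesᵇ x₀) {zs = vertices (pre ++ y ∷ post)} new (begin
        occ v (vertices (pre ++ y₁ ∷ y₂ ∷ post))             ≡⟨ cong (occ v) (concatMap-++ verticesᵇ pre (y₁ ∷ y₂ ∷ post)) ⟩
        occ v (vertices pre ++ vertices (y₁ ∷ y₂ ∷ post))   ≡⟨ occ-++-shift v (vertices pre) {zs = vertices (y ∷ post)} new split ⟩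
        new + occ v (vertices pre ++ vertices (y ∷ post))   ≡⟨ cong (λ L → new + occ v L) (concatMap-++ verticesᵇ pre (y ∷ post)) ⟨
        new + occ v (vertices (pre ++ y ∷ post))            ∎)
      where
      open ≡-Reasoning
      y₁ = block a′ (b y) c′ nothing
      y₂ = block (a y) b′ (c y) (edge y)
      new = occ v (a′ ∷ b′ ∷ c′ ∷ [])
      split : occ v (vertices (y₁ ∷ y₂ ∷ post)) ≡ new + occ v (vertices (y ∷ post))
      split = rearrange (𝟙 (v == a′)) (𝟙 (v == b y)) (𝟙 (v == c′)) (𝟙 (v == a y)) (𝟙 (v == b′))
                        (occ v (after-b (edge y) (c y) ++ vertices post))
        where
        rearrange : ∀ x₁ x₂ x₃ x₄ x₅ r →
          x₁ + (x₂ + (x₃ + (x₄ + (x₅ + r)))) ≡ (x₁ + (x₅ + (x₃ + 0))) + (x₄ + (x₂ + r))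
        rearrange = solve-∀

    absorb : ∀ {x₀} pre y post a′ b′ c′ → part a′ ≡ V₁ → part b′ ≡ V₂ → part c′ ≡ V₃ →
      All (λ v → occ v (vertices (x₀ ∷ pre ++ y ∷ post)) ≡ 0) (a′ ∷ b′ ∷ c′ ∷ []) →
      Absorption a′ b′ c′ (last-c (c x₀) pre) y → Stage₂ x₀ (pre ++ y ∷ post) →
      Stage₂ x₀ (pre ++ block a′ (b y) c′ nothing ∷ block (a y) b′ (c y) (edge y) ∷ post)
    absorb {x₀} pre y post a′ b′ c′ a′∈V₁ b′∈V₂ c′∈V₃ fresh ab st = record
      { cycle = record
        { wellFormed = All.head wellFormed ∷ ++⁺ wf-pre (wf₁ ∷ wf₂ ∷ wf-post)
        ; chain = chain-insert (c x₀) pre y y₁ y₂ post x₀ refl chain u→a′ c′→a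
        ; distinct = distinct-merge {old = vertices (x₀ ∷ pre ++ y ∷ post)} {new = vertices (x₀ ∷ pre ++ y₁ ∷ y₂ ∷ post)}
            (a′ ∷ b′ ∷ c′ ∷ []) distinct (distinct-triple a′∈V₁ b′∈V₂ c′∈V₃)
            (absent-from-members {old = vertices (x₀ ∷ pre ++ y ∷ post)} (a′ ∷ b′ ∷ c′ ∷ []) fresh)
            (λ v → occ-absorbed v x₀ pre y post a′ b′ c′)
        }
      ; all-carried = λ e → carried′ (all-carried e)
      }
      where
      open Stage₂ st
      open BlockCycle cycle
      open Absorption ab
      y₁ = block a′ (b y) c′ nothing
      y₂ = block (a y) b′ (c y) (edge y)
      wf-pre = proj₁ (++⁻ pre (All.tail wellFormed))
      wf-y = All.head (proj₂ (++⁻ pre (All.tail wellFormed)))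
      wf-post = All.tail (proj₂ (++⁻ pre (All.tail wellFormed)))
      wf₁ : WellFormed y₁
      wf₁ = record { a∈V₁ = a′∈V₁ ; b∈V₂ = b∈V₂ wf-y ; c∈V₃ = c′∈V₃ ; a→b = a′→b ; b→ = b→c′ ; →c = tt }
      wf₂ : WellFormed y₂
      wf₂ = record { a∈V₁ = a∈V₁ wf-y ; b∈V₂ = b′∈V₂ ; c∈V₃ = c∈V₃ wf-y
                   ; a→b = a→b′ ; b→ = b′→ ; →c = →c wf-y }
      carried′ : ∀ {e} → Carries e (x₀ ∷ pre ++ y ∷ post) → Carries e (x₀ ∷ pre ++ y₁ ∷ y₂ ∷ post)
      carried′ (here p) = here p
      carried′ (there p) = there (carries-split pre y y₁ y₂ post refl p)

    unused-vertex : ∀ P (Fl : List (Fin N)) → countL (_∈ₚ P) Fl < partSize part P → Σ (Fin N) λ x → (part x ≡ P) × (occ x Fl ≡ 0)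
    unused-vertex P Fl few = fromWitness (count-witness unused (+-cancelʳ-< (countL (_∈ₚ P) Fl) 0 (count unused) (begin-strict
      countL (_∈ₚ P) Fl                                                  <⟨ few ⟩
      count (_∈ₚ P)                                                      ≡⟨ count-split (_∈ₚ P) (λ v → positive (occ v Fl)) ⟩
      count unused + count (λ v → (v ∈ₚ P) ∧ positive (occ v Fl))        ≤⟨ +-monoʳ-≤ (count unused) (count-occurring≤countL (_∈ₚ P) Fl) ⟩
      count unused + countL (_∈ₚ P) Fl                                   ∎)))
      where
      open ≤-Reasoning
      unused : Fin N → Bool
      unused v = (v ∈ₚ P) ∧ not (positive (occ v Fl))
      fromWitness : Σ (Fin N) (λ v → unused v ≡ true) → Σ (Fin N) λ x → (part x ≡ P) × (occ x Fl ≡ 0)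
      fromWitness (x , ux) with ∧-true⇒ {x ∈ₚ P} ux
      ... | x∈P , unused-x = x , ∈ₚ⇒ x∈P , ¬positive⇒≡0 (occ x Fl) unused-x

    share : Fin 3 → Block → ℕ
    share zero y = 1
    share (suc _) y = 1 + 𝟙 (is-just (edge y))

    share-of-block : ∀ P y → WellFormed y → countL (_∈ₚ P) (verticesᵇ y) ≤ share P y
    share-of-block P (block a b c m) wf =
      subst (_≤ share P (block a b c m))
        (sym (trans (countL-map (λ Q → ⌊ Q ≟ P ⌋) part (verticesᵇ (block a b c m))) (cong (countL (λ Q → ⌊ Q ≟ P ⌋)) (parts m refl))))
        (by-part P m)
      where
      pattern₃ : Maybe (Fin k) → List (Fin 3)
      pattern₃ nothing = V₁ ∷ V₂ ∷ V₃ ∷ []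
      pattern₃ (just _) = V₁ ∷ V₂ ∷ V₃ ∷ V₂ ∷ V₃ ∷ []
      parts : ∀ m′ → m′ ≡ m → map part (verticesᵇ (block a b c m′)) ≡ pattern₃ m′
      parts nothing refl = cong₂ _∷_ (a∈V₁ wf) (cong₂ _∷_ (b∈V₂ wf) (cong₂ _∷_ (c∈V₃ wf) refl))
      parts (just e) refl = cong₂ _∷_ (a∈V₁ wf) (cong₂ _∷_ (b∈V₂ wf)
        (cong₂ _∷_ (proj₁ (M-parts e)) (cong₂ _∷_ (proj₂ (M-parts e)) (cong₂ _∷_ (c∈V₃ wf) refl))))
      by-part : ∀ P m′ → countL (λ Q → ⌊ Q ≟ P ⌋) (pattern₃ m′) ≤ share P (block a b c m′)
      by-part zero nothing = ≤-refl
      by-part zero (just _) = ≤-refl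
      by-part (suc zero) nothing = ≤-refl
      by-part (suc zero) (just _) = ≤-refl
      by-part (suc (suc zero)) nothing = ≤-refl
      by-part (suc (suc zero)) (just _) = ≤-refl

    V₁-on-cycle : ∀ Ls → All WellFormed Ls → countL (_∈ₚ V₁) (vertices Ls) ≤ length Ls
    V₁-on-cycle [] [] = z≤n
    V₁-on-cycle (y ∷ Ls) (wf ∷ wfs) rewrite countL-++ (_∈ₚ V₁) (verticesᵇ y) (vertices Ls) =
      +-mono-≤ (share-of-block V₁ y wf) (V₁-on-cycle Ls wfs)

    V₂V₃-on-cycle : ∀ P → ¬ P ≡ V₁ → ∀ Ls → All WellFormed Ls → countL (_∈ₚ P) (vertices Ls) ≤ length Ls + #carrying Ls
    V₂V₃-on-cycle P P≢V₁ [] [] = z≤n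
    V₂V₃-on-cycle zero P≢V₁ (y ∷ Ls) _ = ⊥-elim (P≢V₁ refl)
    V₂V₃-on-cycle (suc P) P≢V₁ (y ∷ Ls) (wf ∷ wfs) rewrite countL-++ (_∈ₚ suc P) (verticesᵇ y) (vertices Ls) =
      ≤-trans (+-mono-≤ (share-of-block (suc P) y wf) (V₂V₃-on-cycle (suc P) P≢V₁ Ls wfs))
              (≤-reflexive (rearrange (𝟙 (is-just (edge y))) (length Ls) (#carrying Ls)))
      where
      rearrange : ∀ j l J → (1 + j) + (l + J) ≡ (1 + l) + (j + J)
      rearrange = solve-∀

    Grown : Block → List Block → Set
    Grown x₀ L = Σ (List Block) λ L′ → length L′ ≡ suc (length L) × Stage₂ x₀ L′

    grow-short : ∀ {x₀ L} → Stage₂ x₀ L → 100 * suc (length L) ≤ 7 * n + 100 → Grown x₀ L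
    grow-short {x₀} {L} st short = grown (extend cycle (sparse-if-short (x₀ ∷ L) (BlockCycle.distinct cycle) short) nothing tt)
      where
      open Stage₂ st
      grown : Extension x₀ L nothing → Grown x₀ L
      grown ext = Extension.new ext ∷ L , refl , record
        { cycle = Extension.cycle ext
        ; all-carried = λ e → carries-after-x₀ (Extension.new ext) L (all-carried e)
        }

    V₂V₃-not-full : ∀ {x₀ L} → BlockCycle x₀ L → suc (length L) < partSize part V₁ →
      ∀ P → partSize part P ≡ n → ¬ P ≡ V₁ → countL (_∈ₚ P) (vertices (x₀ ∷ L)) < partSize part P
    V₂V₃-not-full {x₀} {L} cyc room P |P|≡n P≢V₁ = begin-strict
      countL (_∈ₚ P) (vertices (x₀ ∷ L))       ≤⟨ V₂V₃-on-cycle P P≢V₁ (x₀ ∷ L) (BlockCycle.wellFormed cyc) ⟩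
      suc (length L) + #carrying (x₀ ∷ L)       <⟨ +-monoˡ-< (#carrying (x₀ ∷ L)) room ⟩
      partSize part V₁ + #carrying (x₀ ∷ L)     ≤⟨ +-monoʳ-≤ (partSize part V₁) (#carrying≤k (x₀ ∷ L) (BlockCycle.distinct cyc)) ⟩
      partSize part V₁ + k                      ≡⟨ trans |V₁|+k≡n (sym |P|≡n) ⟩
      partSize part P                           ∎
      where open ≤-Reasoning

    grow-long : ∀ {x₀ L} → Stage₂ x₀ L → suc (length L) < partSize part V₁ → 7 * n < 100 * length L → Grown x₀ L
    grow-long {x₀} {L} st room long = inserted (absorbing-window cycle a′∈V₁ b′∈V₂ c′∈V₃ long)
      where
      open Stage₂ st
      Fl = vertices (x₀ ∷ L)
      α = unused-vertex V₁ Fl (≤-<-trans (V₁-on-cycle (x₀ ∷ L) (BlockCycle.wellFormed cycle)) room)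
      β = unused-vertex V₂ Fl (V₂V₃-not-full cycle room V₂ |V₂|≡n λ ())
      γ = unused-vertex V₃ Fl (V₂V₃-not-full cycle room V₃ |V₃|≡n λ ())
      a′ = proj₁ α
      b′ = proj₁ β
      c′ = proj₁ γ
      a′∈V₁ = proj₁ (proj₂ α)
      b′∈V₂ = proj₁ (proj₂ β)
      c′∈V₃ = proj₁ (proj₂ γ)
      inserted : (Σ (List Block) λ pre → Σ Block λ y → Σ (List Block) λ post →
                    (L ≡ pre ++ y ∷ post) × (Absorbs a′ b′ c′ (last-c (c x₀) pre , y) ≡ true)) → Grown x₀ L
      inserted (pre , y , post , refl , absorbs) =
        pre ++ block a′ (b y) c′ nothing ∷ block (a y) b′ (c y) (edge y) ∷ post ,
        trans (length-++ pre) (trans (+-suc (length pre) _) (cong suc (sym (length-++ pre)))) ,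
        absorb pre y post a′ b′ c′ a′∈V₁ b′∈V₂ c′∈V₃ (proj₂ (proj₂ α) ∷ proj₂ (proj₂ β) ∷ proj₂ (proj₂ γ) ∷ [])
          (absorbs⇒ absorbs) st

    stage₂-step : ∀ {x₀ L} → Stage₂ x₀ L → suc (length L) < partSize part V₁ → Grown x₀ L
    stage₂-step {x₀} {L} st room = by-length (100 * suc (length L) ≤? 7 * n + 100)
      where
      by-length : Dec (100 * suc (length L) ≤ 7 * n + 100) → Grown x₀ L
      by-length (yes short) = grow-short st short
      by-length (no ¬short) = grow-long st room (+-cancelʳ-< 100 (7 * n) (100 * length L)
        (subst (7 * n + 100 <_) (trans (*-suc 100 (length L)) (+-comm 100 (100 * length L))) (≰⇒> ¬short)))

    stage₂ : ∀ r {x₀ L} → suc (length L) + r ≡ partSize part V₁ → Stage₂ x₀ L →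
      Σ (List Block) λ L′ → suc (length L′) ≡ partSize part V₁ × Stage₂ x₀ L′
    stage₂ zero {L = L} full st = L , trans (sym (+-identityʳ (suc (length L)))) full , st
    stage₂ (suc r) {x₀} {L} sizes st = continue (stage₂-step st room)
      where
      sizes′ : suc (suc (length L) + r) ≡ partSize part V₁
      sizes′ = trans (sym (+-suc (suc (length L)) r)) sizes
      room : suc (length L) < partSize part V₁
      room = ≤-trans (s≤s (m≤m+n (suc (length L)) r)) (≤-reflexive sizes′)
      continue : Grown x₀ L → Σ (List Block) λ L′ → suc (length L′) ≡ partSize part V₁ × Stage₂ x₀ L′
      continue (L′ , grew , st′) = stage₂ r (trans (cong (λ l → suc l + r) grew) sizes′) st′

    carried-edges : List Block → List (Fin k)
    carried-edges [] = []
    carried-edges (block _ _ _ nothing ∷ Ls) = carried-edges Ls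
    carried-edges (block _ _ _ (just e) ∷ Ls) = e ∷ carried-edges Ls

    k≤#carrying : ∀ Ls → (∀ e → Carries e Ls) → k ≤ #carrying Ls
    k≤#carrying Ls all-carried = begin
      k                                                           ≡⟨ count-const-true {k} ⟨
      count {k} (λ _ → true)                                      ≤⟨ count-mono (λ e _ → positive-occ (all-carried e)) ⟩
      count (λ e → true ∧ positive (occ e (carried-edges Ls)))    ≤⟨ count-occurring≤countL (λ _ → true) (carried-edges Ls) ⟩
      countL (λ _ → true) (carried-edges Ls)                      ≤⟨ countL≤length _ (carried-edges Ls) ⟩
      length (carried-edges Ls)                                   ≡⟨ length-carried Ls ⟩
      #carrying Ls                                                ∎
      where
      open ≤-Reasoning
      positive-occ : ∀ {e Ls} → Carries e Ls → positive (occ e (carried-edges Ls)) ≡ true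
      positive-occ {e} {block _ _ _ (just e′) ∷ Ls} (here refl) rewrite ==-refl e = refl
      positive-occ {e} {block _ _ _ nothing ∷ Ls} (there p) = positive-occ p
      positive-occ {e} {block _ _ _ (just e′) ∷ Ls} (there p) with e == e′
      ... | true = refl
      ... | false = positive-occ p
      length-carried : ∀ Ls → length (carried-edges Ls) ≡ #carrying Ls
      length-carried [] = refl
      length-carried (block _ _ _ nothing ∷ Ls) = length-carried Ls
      length-carried (block _ _ _ (just e) ∷ Ls) = cong suc (length-carried Ls)

    carrier : ∀ {e} Ls → Carries e Ls →
      Σ (List Block) λ pre → Σ Block λ y → Σ (List Block) λ post → (Ls ≡ pre ++ y ∷ post) × (edge y ≡ just e)
    carrier (y ∷ Ls) (here p) = [] , y , Ls , refl , p
    carrier (y ∷ Ls) (there p) with carrier Ls p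
    ... | pre , y′ , post , Ls≡ , q = y ∷ pre , y′ , post , cong (y ∷_) Ls≡ , q

    vertices-around : ∀ e pre y post → edge y ≡ just e →
      vertices (pre ++ y ∷ post) ≡ (vertices pre ++ a y ∷ b y ∷ []) ++ tail e ∷ head e ∷ c y ∷ vertices post
    vertices-around e pre (block a′ b′ c′ .(just e)) post refl =
      trans (concatMap-++ verticesᵇ pre (block a′ b′ c′ (just e) ∷ post))
            (sym (++-assoc (vertices pre) (a′ ∷ b′ ∷ []) (tail e ∷ head e ∷ c′ ∷ vertices post)))

    HamiltonCycleThroughM : Set
    HamiltonCycleThroughM = Σ (HamiltonCycle adj) λ C → ∀ e → InCycle C (tail e) (head e)

    close : ∀ {x₀ L} → suc (length L) ≡ partSize part V₁ → Stage₂ x₀ L → HamiltonCycleThroughM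
    close {x₀} {L} full st = proj₁ H , λ e → through (carrier (x₀ ∷ L) (all-carried e))
      where
      open Stage₂ st
      open BlockCycle cycle
      #carrying≡k : #carrying (x₀ ∷ L) ≡ k
      #carrying≡k = ≤-antisym (#carrying≤k (x₀ ∷ L) distinct) (k≤#carrying (x₀ ∷ L) all-carried)
      length≡N : length (vertices (x₀ ∷ L)) ≡ N
      length≡N = begin
        length (vertices (x₀ ∷ L))                            ≡⟨ length-vertices (x₀ ∷ L) ⟩
        3 * suc (length L) + 2 * #carrying (x₀ ∷ L)           ≡⟨ cong₂ (λ l j → 3 * l + 2 * j) full #carrying≡k ⟩
        3 * partSize part V₁ + 2 * k                          ≡⟨ regroup (partSize part V₁) k ⟩
        partSize part V₁ + ((partSize part V₁ + k) + (partSize part V₁ + k)) ≡⟨ cong (λ m → partSize part V₁ + (m + m)) |V₁|+k≡n ⟩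
        partSize part V₁ + (n + n)                            ≡⟨ cong (partSize part V₁ +_) (cong₂ _+_ |V₂|≡n |V₃|≡n) ⟨
        partSize part V₁ + (partSize part V₂ + partSize part V₃) ≡⟨ partSizes-sum part ⟩
        N                                                     ∎
        where
        open ≡-Reasoning
        regroup : ∀ p k → 3 * p + 2 * k ≡ p + ((p + k) + (p + k))
        regroup = solve-∀
      H = hamiltonCycle (a x₀) (b x₀ ∷ after-b (edge x₀) (c x₀) ++ vertices L) length≡N distinct
            (through-block x₀ (All.head wellFormed) (chain⇒walk L x₀ (All.tail wellFormed) chain))
      through : ∀ {e} → (Σ (List Block) λ pre → Σ Block λ y → Σ (List Block) λ post →
                           (x₀ ∷ L ≡ pre ++ y ∷ post) × (edge y ≡ just e)) →
                InCycle (proj₁ H) (tail e) (head e)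
      through {e} (pre , y , post , split , carries) =
        proj₂ H (vertices pre ++ a y ∷ b y ∷ []) (tail e) (head e) (c y ∷ vertices post)
          (trans (cong vertices split) (vertices-around e pre y post carries))

    1+k≤|V₁| : suc k ≤ partSize part V₁
    1+k≤|V₁| = +-cancelʳ-≤ k (suc k) (partSize part V₁) (≤-trans (*-cancelˡ-≤ 100 (begin
      100 * (suc k + k)          ≡⟨ expand k ⟩
      100 + 2 * (100 * k)        ≤⟨ +-mono-≤ 100≤n (*-monoʳ-≤ 2 100k≤n) ⟩
      n + 2 * n                  ≡⟨ triple n ⟩
      3 * n                      ≤⟨ *-monoˡ-≤ n (m≤m+n 3 97) ⟩
      100 * n                    ∎)) (≤-reflexive (sym |V₁|+k≡n)))
      where
      open ≤-Reasoning
      expand : ∀ k → 100 * (suc k + k) ≡ 100 + 2 * (100 * k)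
      expand = solve-∀
      triple : ∀ n → n + 2 * n ≡ 3 * n
      triple = solve-∀

    stage₁⇒stage₂ : ∀ {x₀ L} → Stage₁ k x₀ L → Stage₂ x₀ L
    stage₁⇒stage₂ st = record { cycle = cycle ; all-carried = λ e → carried e (toℕ<n e) }
      where open Stage₁ st

    hamilton-cycle-through-M : HamiltonCycleThroughM
    hamilton-cycle-through-M = after-stage₁ (stage₁ k ≤-refl)
      where
      after-stage₂ : ∀ {x₀} → (Σ (List Block) λ L → suc (length L) ≡ partSize part V₁ × Stage₂ x₀ L) → HamiltonCycleThroughM
      after-stage₂ (L , full , st) = close full st
      after-stage₁ : (Σ Block λ x₀ → Σ (List Block) (Stage₁ k x₀)) → HamiltonCycleThroughM
      after-stage₁ (x₀ , L , st) =
        after-stage₂ (stage₂ (partSize part V₁ ∸ suc k) (trans (cong suc (cong (_+ _) (Stage₁.size st))) (m+[n∸m]≡n 1+k≤|V₁|))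
          (stage₁⇒stage₂ st))


module DegreeBounds where
  open import Data.Bool using (_∧_; not)
  open import Data.Fin using (zero; suc)
  open import Data.Fin.Properties using (_≟_)
  open import Data.Integer using (+_; +<+)
  open import Data.Integer.Properties using (drop‿+≤+; *-identityʳ; pos-*)
  import Data.Integer as ℤ
  open import Data.Nat using (_+_; _*_; _∸_; _≤_; z≤n; s≤s)
  open import Data.Nat.Properties
    using (+-cancelʳ-≤; +-mono-≤; ≤-refl; ≤-reflexive; *-distribˡ-+; *-monoʳ-≤; *-comm; +-comm; m+[n∸m]≡n; module ≤-Reasoning)
  open import Data.Nat.Tactic.RingSolver using (solve-∀)
  open import Data.Rational using (ℚ; 0ℚ; 1ℚ; _-_; _/_; toℚᵘ; *<*)
  import Data.Rational as ℚ
  open import Data.Rational.Properties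
    using (+-monoʳ-≤; neg-antimono-≤; *-monoʳ-≤-nonNeg; toℚᵘ-mono-≤; toℚᵘ-homo-*; toℚᵘ-fromℚᵘ; normalize-nonNeg)
    renaming (≤-trans to ≤ℚ-trans)
  import Data.Rational.Unnormalised as ℚᵘ
  import Data.Rational.Unnormalised.Properties as ℚᵘ
  open import Relation.Nullary.Decidable using (⌊_⌋)
  open import Relation.Binary.PropositionalEquality
  open Counting using (count-split)

  ε₀ : ℚ
  ε₀ = + 1 / 100

  0<ε₀ : 0ℚ ℚ.< ε₀
  0<ε₀ = *<* (+<+ (s≤s z≤n))

  99n≤100d : ∀ {ε} n d → ε ℚ.≤ ε₀ → (1ℚ - ε) ℚ.* ℕtoℚ n ℚ.≤ ℕtoℚ d → 99 * n ≤ 100 * d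
  99n≤100d {ε} n d ε≤ε₀ almost = from-unnormalised (toℚᵘ-mono-≤ at-ε₀)
    where
    at-ε₀ : (1ℚ - ε₀) ℚ.* ℕtoℚ n ℚ.≤ ℕtoℚ d
    at-ε₀ = ≤ℚ-trans (*-monoʳ-≤-nonNeg (ℕtoℚ n) {{normalize-nonNeg n 1}} (+-monoʳ-≤ 1ℚ (neg-antimono-≤ ε≤ε₀))) almost
    from-unnormalised : toℚᵘ ((1ℚ - ε₀) ℚ.* ℕtoℚ n) ℚᵘ.≤ toℚᵘ (ℕtoℚ d) → 99 * n ≤ 100 * d
    from-unnormalised le with ℚᵘ.≤-respʳ-≃ (toℚᵘ-fromℚᵘ (ℚᵘ.mkℚᵘ (+ d) 0)) (ℚᵘ.≤-respˡ-≃ lhs le)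
      where
      lhs : toℚᵘ ((1ℚ - ε₀) ℚ.* ℕtoℚ n) ℚᵘ.≃ ℚᵘ.mkℚᵘ (+ 99) 99 ℚᵘ.* ℚᵘ.mkℚᵘ (+ n) 0
      lhs = ℚᵘ.≃-trans (toℚᵘ-homo-* (1ℚ - ε₀) (ℕtoℚ n)) (ℚᵘ.*-congˡ {toℚᵘ (1ℚ - ε₀)} (toℚᵘ-fromℚᵘ (ℚᵘ.mkℚᵘ (+ n) 0)))
    ... | ℚᵘ.*≤* cross = drop‿+≤+ (subst₂ ℤ._≤_ left right cross)
      where
      left : (+ 99 ℤ.* + n) ℤ.* + 1 ≡ + (99 * n)
      left = trans (*-identityʳ _) (sym (pos-* 99 n))
      right : + d ℤ.* + 100 ≡ + (100 * d)
      right = trans (sym (pos-* d 100)) (cong +_ (*-comm d 100))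

  100·missing≤n : ∀ n missing present total → total ≡ missing + present → total ≤ n → 99 * n ≤ 100 * present →
    100 * missing ≤ n
  100·missing≤n n missing present total split total≤n 99n≤ = +-cancelʳ-≤ (99 * n) (100 * missing) n (begin
    100 * missing + 99 * n        ≤⟨ +-mono-≤ (≤-refl {100 * missing}) 99n≤ ⟩
    100 * missing + 100 * present ≡⟨ *-distribˡ-+ 100 missing present ⟨
    100 * (missing + present)     ≡⟨ cong (100 *_) split ⟨
    100 * total                   ≤⟨ *-monoʳ-≤ 100 total≤n ⟩
    100 * n                       ≡⟨ split-100 n ⟩
    n + 99 * n                    ∎)
    where
    open ≤-Reasoning
    split-100 : ∀ n → 100 * n ≡ n + 99 * n
    split-100 = solve-∀

  module _ {N} (adj : Fin N → Fin N → Bool) (part : Fin N → Fin 3) {n : ℕ} {ε : ℚ} (ε≤ε₀ : ε ℚ.≤ ε₀) where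

    few-unmatched : partSize part zero ≤ n → (1ℚ - ε) ℚ.* ℕtoℚ n ℚ.≤ ℕtoℚ (partSize part zero) →
      100 * (n ∸ partSize part zero) ≤ n
    few-unmatched |V₁|≤n |V₁|≥ = 100·missing≤n n (n ∸ partSize part zero) (partSize part zero) n
      (trans (sym (m+[n∸m]≡n |V₁|≤n)) (+-comm (partSize part zero) (n ∸ partSize part zero))) ≤-refl
      (99n≤100d n (partSize part zero) ε≤ε₀ |V₁|≥)

    few-non-out-neighbours : ∀ v P → partSize part P ≤ n → (1ℚ - ε) ℚ.* ℕtoℚ n ℚ.≤ ℕtoℚ (outdeg adj part v P) →
      100 * count (λ w → ⌊ part w ≟ P ⌋ ∧ not (adj v w)) ≤ n
    few-non-out-neighbours v P |P|≤n deg = 100·missing≤n n _ (outdeg adj part v P) (partSize part P)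
      (count-split (λ w → ⌊ part w ≟ P ⌋) (adj v)) |P|≤n (99n≤100d n (outdeg adj part v P) ε≤ε₀ deg)

    few-non-in-neighbours : ∀ v P → partSize part P ≤ n → (1ℚ - ε) ℚ.* ℕtoℚ n ℚ.≤ ℕtoℚ (indeg adj part v P) →
      100 * count (λ w → ⌊ part w ≟ P ⌋ ∧ not (adj w v)) ≤ n
    few-non-in-neighbours v P |P|≤n deg = 100·missing≤n n _ (indeg adj part v P) (partSize part P)
      (count-split (λ w → ⌊ part w ≟ P ⌋) (λ w → adj w v)) |P|≤n (99n≤100d n (indeg adj part v P) ε≤ε₀ deg)

  parts≤n : ∀ {N} (part : Fin N → Fin 3) {n} → partSize part zero ≤ n → partSize part (suc zero) ≡ n →
    partSize part (suc (suc zero)) ≡ n → ∀ P → partSize part P ≤ n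
  parts≤n part |V₁|≤n _ _ zero = |V₁|≤n
  parts≤n part _ |V₂|≡n _ (suc zero) = ≤-reflexive |V₂|≡n
  parts≤n part _ _ |V₃|≡n (suc (suc zero)) = ≤-reflexive |V₃|≡n


open import Data.Nat using (ℕ; zero; suc; _∸_; _≥_)
open import Data.Fin using (Fin; zero; suc)
open import Data.Bool using (Bool)
open import Data.Product using (Σ; ∃; _×_; _,_)
open import Data.Rational using (ℚ; 0ℚ; 1ℚ; _-_; _*_; _≤_; _<_)
open import Relation.Binary.PropositionalEquality using (_≡_)

open import Data.Nat.Properties using (m+[n∸m]≡n)
open import Data.Product using (proj₁; proj₂)
open DegreeBounds

lemma4p20 : ∃ λ (ε₀ : ℚ) → (0ℚ < ε₀) ×
    (∀ (ε : ℚ) → 0ℚ < ε → ε ≤ ε₀ →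
      ∃ λ (n₀ : ℕ) → ∀ (n : ℕ) → n ≥ n₀ →
        ∀ (N : ℕ) (adj : Fin N → Fin N → Bool) (part : Fin N → Fin 3) →
        Tripartite adj part →
        (1ℚ - ε) * ℕtoℚ n ≤ ℕtoℚ (partSize part zero) →
        partSize part zero Data.Nat.≤ n →
        partSize part (suc zero) ≡ n →
        partSize part (suc (suc zero)) ≡ n →
        (∀ (v : Fin N) →
          ((1ℚ - ε) * ℕtoℚ n ≤ ℕtoℚ (outdeg adj part v (next3 (part v)))) ×
          ((1ℚ - ε) * ℕtoℚ n ≤ ℕtoℚ (indeg adj part v (prev3 (part v))))) →
        (M : Matching adj (n ∸ partSize part zero)) →
        (∀ e → (part (Matching.tail M e) ≡ suc (suc zero)) × (part (Matching.head M e) ≡ suc zero)) →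
        Σ (HamiltonCycle adj) λ C →
          ∀ e → InCycle C (Matching.tail M e) (Matching.head M e))
lemma4p20 = ε₀ , 0<ε₀ , λ ε _ ε≤ε₀ → 100 , λ n 100≤n N adj part _ |V₁|≥ |V₁|≤n |V₂|≡n |V₃|≡n degrees M M-parts →
  let |V|≤n = parts≤n part |V₁|≤n |V₂|≡n |V₃|≡n in
  Construction.hamilton-cycle-through-M adj part n (n ∸ partSize part zero) M M-parts
    (m+[n∸m]≡n |V₁|≤n) |V₂|≡n |V₃|≡n (few-unmatched adj part ε≤ε₀ |V₁|≤n |V₁|≥) 100≤n
    (λ v → few-non-out-neighbours adj part ε≤ε₀ v (next3 (part v)) (|V|≤n (next3 (part v))) (proj₁ (degrees v)))
    (λ v → few-non-in-neighbours adj part ε≤ε₀ v (prev3 (part v)) (|V|≤n (prev3 (part v))) (proj₂ (degrees v)))
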